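{- Let $A \subseteq \mathbb{N}$ be a primitive set and let $N \ge 2$. Then \[ \sum_{\substack{a \in A \\ P(a) \le N}} \frac{2^{\Omega(a)}}{a} \le \prod_{2 < p \le N}\Bigl(1 - \frac{2}{p}\Bigr)^{ -1} \ll (\log N)^2, \] where the sum is over those $a \in A$ all of whose prime factors are at most $N$, the product is over primes, and the implied constant is absolute.
   Context: A set $A \subseteq \mathbb{N}$ is primitive if for $a_1, a_2 \in A$, $a_1 \mid a_2$ implies $a_1 = a_2$. $\Omega(a)$ is the number of prime factors of $a$ counted with multiplicity; $P(a)$ is the largest prime factor of $a$. -}

module Defs where

open import Data.Nat as ℕ using (ℕ; zero; suc; _≤_; _<_; _^_)
open import Data.Nat.Divisibility using (_∣_)
open import Data.Nat.Primality using (Prime; prime?)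
open import Data.Nat.Primality.Factorisation using (factorise; PrimeFactorisation)
open import Data.List using (List; []; _∷_; length; foldr; map)
open import Data.Integer using (+_)
open import Data.Rational as ℚ using (ℚ; _/_; 0ℚ; 1ℚ)
open import Relation.Binary.PropositionalEquality using (_≡_)
open import Relation.Nullary using (yes; no)

Primitive : (ℕ → Set) → Set
Primitive A = ∀ a b → A a → A b → a ∣ b → a ≡ b

-- Ω(a): number of prime factors of a counted with multiplicity (a ≥ 1);
-- Ω(0) := 0 is a junk value never used below.
Ω : ℕ → ℕ
Ω zero = 0
Ω n@(suc _) = length (PrimeFactorisation.factors (factorise n))

-- "P(a) ≤ N": every prime factor of a is at most N (for a = 1 this holds vacuously).
Smooth : ℕ → ℕ → Set
Smooth N a = ∀ p → Prime p → p ∣ a → p ≤ N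

-- the summand 2^Ω(a) / a  (junk value 0 at a = 0, never used)
term : ℕ → ℚ
term zero = 0ℚ
term n@(suc _) = (+ (2 ^ Ω n)) / n

sumℚ : List ℚ → ℚ
sumℚ = foldr ℚ._+_ 0ℚ

-- (1 - 2/p)⁻¹ = p / (p - 2) for p ≥ 3 (junk value 1 for p ≤ 2, never used)
eulerFactor : ℕ → ℚ
eulerFactor (suc (suc (suc k))) = (+ (3 ℕ.+ k)) / (suc k)
eulerFactor _ = 1ℚ

prodFactor : ℕ → ℚ
prodFactor zero = 1ℚ
prodFactor (suc n) with prime? (suc n) | 2 ℕ.<? suc n
... | yes _ | yes _ = prodFactor n ℚ.* eulerFactor (suc n)
... | _     | _     = prodFactor n

-- Replacing a by its odd part m (a = 2^k m) does not change 2^Ω(a)/a, and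
-- in a primitive set distinct elements have distinct odd parts.  For distinct odd N-smooth numbers,
-- induction on N splits off the largest odd prime p ≤ N: the numbers prime to p contribute at
-- most the product X over smaller primes, and the multiples p q contribute (2/p) times a sum of
-- the same kind, so the bound X · p/(p - 2) is a fixed point because 1 + (2/p) · p/(p - 2) = p/(p - 2).
--
-- This is Mertens' theorem ∏ (1 - 1/p)^-1 ≪ log N, squared, done in ℕ.  Put
-- n = 2^(K+2) > N with K + 1 = ⌊log₂ N⌋ and ρ = 1 + 1/n.  Bernoulli's inequality gives
-- p/(p - 2) ≤ ρ^(2 + ⌊n/(p-1)⌋ + ⌊n/(p-2)⌋), and since odd primes are at least 2 apart the total
-- exponent is at most 2 ∑_p ⌊n/p⌋ + O(n).  Counting prime divisors of 1, …, n (Mertens' first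
-- theorem with weights ⌊log₂ p⌋), Chebyshev's bound θ(x) ≤ 2x from the central binomial
-- coefficient and Abel summation over dyadic blocks give ∑_{p<n} ⌊n/p⌋ ≤ ∑_{2≤j≤K+1} ⌊n/j⌋ + O(n).
-- Finally ρ^⌊n/j⌋ ≤ j/(j - 1) telescopes to ρ^(∑_j ⌊n/j⌋) ≤ K + 1, and ρ^(n/2) ≤ 2.

module Submission where

open import Data.Empty using (⊥-elim)
open import Data.Integer as ℤ using (+_)
import Data.Integer.Properties as ℤ
open import Data.List using (List; []; _∷_; length; map; filter)
open import Data.List.Properties using (map-∘; map-cong)
open import Data.List.Relation.Binary.Permutation.Propositional.Properties using (↭-length)
open import Data.List.Relation.Unary.All as All using (All; []; _∷_)
import Data.List.Relation.Unary.All.Properties as Allₚ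
open import Data.List.Relation.Unary.AllPairs using ([]; _∷_)
open import Data.List.Relation.Unary.Unique.Propositional using (Unique)
import Data.List.Relation.Unary.Unique.Propositional.Properties as Uniqueₚ
open import Data.Nat
open import Data.Nat.Combinatorics using (_C_; nCk≡n!/k![n-k]!; k![n∸k]!∣n!; nCk+nC[k+1]≡[n+1]C[k+1])
open import Data.Nat.Divisibility
open import Data.Nat.DivMod
  using (m≡m%n+[m/n]*n; m%n<n; m/n*n≤m; m/n≤m; m/n*n≡m; m*[n/m]≡n; m/n<m; m≥n⇒m/n>0; /-monoʳ-≤; m<n*o⇒m/o<n)
open import Data.Nat.Induction using (<-rec)
open import Data.Nat.ListAction using (product)
open import Data.Nat.ListAction.Properties using (∈⇒≤product)
open import Data.Nat.Logarithm
  using (⌊log₂_⌋; ⌊log₂⌋-mono-≤; ⌊log₂[2^n]⌋≡n; ⌊log₂⌊n/2⌋⌋≡⌊log₂n⌋∸1)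
open import Data.Nat.Primality
open import Data.Nat.Primality.Factorisation using (PrimeFactorisation; factorise; factorisationUnique)
open import Data.Nat.Properties
open import Algebra.Properties.CommutativeSemigroup +-commutativeSemigroup
  using () renaming (interchange to +-interchange)
open import Algebra.Properties.CommutativeSemigroup *-commutativeSemigroup using (x∙yz≈y∙xz)
open import Data.Nat.Tactic.RingSolver using (solve-∀)
open import Data.Product using (Σ; _×_; _,_; proj₁)
open import Data.Rational as ℚ using (ℚ; 0ℚ; 1ℚ; toℚᵘ)
import Data.Rational.Properties as ℚ
open import Data.Rational.Unnormalised as ℚᵘ using (mkℚᵘ; *≡*; *≤*; _≃_)
import Data.Rational.Unnormalised.Properties as ℚᵘ
open import Data.Sum using (inj₁; inj₂)
open import Relation.Binary.PropositionalEquality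
open import Relation.Nullary using (Dec; yes; no; ¬_)
open import Relation.Unary using (Decidable)
open import Relation.Unary.Properties using (∁?)

open import Defs

∑< : ℕ → (ℕ → ℕ) → ℕ
∑< zero    f = 0
∑< (suc n) f = ∑< n f + f n

-- The summand extends only over an application: ∑[ i < n ] f i + c is (∑[ i < n ] f i) + c.
syntax ∑< n (λ i → e) = ∑[ i < n ] e

∑-cong : ∀ n {f g : ℕ → ℕ} → (∀ i → i < n → f i ≡ g i) → ∑< n f ≡ ∑< n g
∑-cong zero    _  = refl
∑-cong (suc n) eq = cong₂ _+_ (∑-cong n (λ i i<n → eq i (m<n⇒m<1+n i<n))) (eq n ≤-refl)

∑-mono-≤ : ∀ n {f g : ℕ → ℕ} → (∀ i → i < n → f i ≤ g i) → ∑< n f ≤ ∑< n g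
∑-mono-≤ zero    _  = z≤n
∑-mono-≤ (suc n) le = +-mono-≤ (∑-mono-≤ n (λ i i<n → le i (m<n⇒m<1+n i<n))) (le n ≤-refl)

∑-distrib-+ : ∀ n (f g : ℕ → ℕ) → ∑[ i < n ] (f i + g i) ≡ ∑< n f + ∑< n g
∑-distrib-+ zero    f g = refl
∑-distrib-+ (suc n) f g = trans (cong (_+ (f n + g n)) (∑-distrib-+ n f g))
                                (+-interchange (∑< n f) (∑< n g) (f n) (g n))

∑-distribˡ-* : ∀ n c (f : ℕ → ℕ) → ∑[ i < n ] (c * f i) ≡ c * ∑< n f
∑-distribˡ-* zero    c f = sym (*-zeroʳ c)
∑-distribˡ-* (suc n) c f = begin
  ∑[ i < n ] (c * f i) + c * f n  ≡⟨ cong (_+ c * f n) (∑-distribˡ-* n c f) ⟩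
  c * ∑< n f + c * f n            ≡⟨ *-distribˡ-+ c (∑< n f) (f n) ⟨
  c * (∑< n f + f n)              ∎
  where open ≡-Reasoning

∑-const : ∀ n c → ∑[ _ < n ] c ≡ n * c
∑-const zero    c = refl
∑-const (suc n) c = trans (cong (_+ c) (∑-const n c)) (+-comm (n * c) c)

∑-comm : ∀ m n (f : ℕ → ℕ → ℕ) → ∑[ i < m ] ∑[ j < n ] f i j ≡ ∑[ j < n ] ∑[ i < m ] f i j
∑-comm zero    n f = sym (trans (∑-const n 0) (*-zeroʳ n))
∑-comm (suc m) n f = begin
  ∑[ i < m ] ∑[ j < n ] f i j + ∑[ j < n ] f m j  ≡⟨ cong (_+ ∑[ j < n ] f m j) (∑-comm m n f) ⟩
  ∑[ j < n ] ∑[ i < m ] f i j + ∑[ j < n ] f m j  ≡⟨ ∑-distrib-+ n (λ j → ∑[ i < m ] f i j) (f m) ⟨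
  ∑[ j < n ] (∑[ i < m ] f i j + f m j)          ∎
  where open ≡-Reasoning

∑-split : ∀ m n (f : ℕ → ℕ) → ∑< (m + n) f ≡ ∑< m f + ∑[ i < n ] f (m + i)
∑-split m zero    f = trans (cong (λ k → ∑< k f) (+-identityʳ m)) (sym (+-identityʳ (∑< m f)))
∑-split m (suc n) f = begin
  ∑< (m + suc n) f                             ≡⟨ cong (λ k → ∑< k f) (+-suc m n) ⟩
  ∑< (m + n) f + f (m + n)                     ≡⟨ cong (_+ f (m + n)) (∑-split m n f) ⟩
  ∑< m f + ∑[ i < n ] f (m + i) + f (m + n)    ≡⟨ +-assoc (∑< m f) (∑[ i < n ] f (m + i)) (f (m + n)) ⟩
  ∑< m f + (∑[ i < n ] f (m + i) + f (m + n))  ∎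
  where open ≡-Reasoning

∑-shift : ∀ n (f : ℕ → ℕ) → ∑< (suc n) f ≡ f 0 + ∑[ i < n ] f (suc i)
∑-shift n f = ∑-split 1 n f

∑-mono-range : ∀ (f : ℕ → ℕ) {m n} → m ≤ n → ∑< m f ≤ ∑< n f
∑-mono-range f {m} m≤n with m≤n⇒∃[o]m+o≡n m≤n
... | k , refl = subst (∑< m f ≤_) (sym (∑-split m k f)) (m≤m+n (∑< m f) _)

summation-by-parts : ∀ (t : ℕ → ℕ) k → k * ∑< k t ≡ ∑[ i < k ] (suc i * t i) + ∑[ l < k ] ∑< l t
summation-by-parts t zero    = refl
summation-by-parts t (suc k) = begin
  suc k * (A + t k)           ≡⟨ expand k A (t k) ⟩
  k * A + suc k * t k + A     ≡⟨ cong (λ x → x + suc k * t k + A) (summation-by-parts t k) ⟩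
  U + AA + suc k * t k + A    ≡⟨ regroup U AA (suc k * t k) A ⟩
  U + suc k * t k + (AA + A)  ∎
  where
  open ≡-Reasoning
  A  = ∑< k t
  U  = ∑[ i < k ] (suc i * t i)
  AA = ∑[ l < k ] ∑< l t
  expand : ∀ k a x → suc k * (a + x) ≡ k * a + suc k * x + a
  expand = solve-∀
  regroup : ∀ u s y a → u + s + y + a ≡ u + y + (s + a)
  regroup = solve-∀

abel-≤ : ∀ (t b : ℕ → ℕ) K →
  (∀ k → k ≤ K → ∑[ i < k ] (suc i * t i) ≤ ∑[ i < k ] (suc i * b i)) → ∑< K t ≤ ∑< K b
abel-≤ t b K weighted≤ = proj₁ (partial-sums K ≤-refl)
  where
  partial-sums : ∀ k → k ≤ K → ∑< k t ≤ ∑< k b × ∑[ l < k ] ∑< l t ≤ ∑[ l < k ] ∑< l b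
  partial-sums zero    _     = z≤n , z≤n
  partial-sums (suc k) 1+k≤K with partial-sums k (<⇒≤ 1+k≤K)
  ... | A≤ , AA≤ = *-cancelˡ-≤ (suc k) (begin
    suc k * ∑< (suc k) t                                  ≡⟨ summation-by-parts t (suc k) ⟩
    ∑[ i < suc k ] (suc i * t i) + ∑[ l < suc k ] ∑< l t  ≤⟨ +-mono-≤ (weighted≤ (suc k) 1+k≤K)
                                                                        (+-mono-≤ AA≤ A≤) ⟩
    ∑[ i < suc k ] (suc i * b i) + ∑[ l < suc k ] ∑< l b  ≡⟨ summation-by-parts b (suc k) ⟨
    suc k * ∑< (suc k) b                                  ∎) , +-mono-≤ AA≤ A≤
    where open ≤-Reasoning

when : ∀ {a} {A : Set a} → Dec A → ℕ → ℕ
when (yes _) x = x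
when (no  _) _ = 0

when≡*when1 : ∀ {a} {A : Set a} (A? : Dec A) x → when A? x ≡ x * when A? 1
when≡*when1 (yes _) x = sym (*-identityʳ x)
when≡*when1 (no _)  x = sym (*-zeroʳ x)

-- Total so that it can be summed over all p; ⌊ n / 0 ⌋ = 0 is a junk value.
⌊_/_⌋ : ℕ → ℕ → ℕ
⌊ n / zero  ⌋ = 0
⌊ n / suc d ⌋ = n / suc d

⌊n/d⌋*d≤n : ∀ n d → ⌊ n / d ⌋ * d ≤ n
⌊n/d⌋*d≤n n zero    = z≤n
⌊n/d⌋*d≤n n (suc d) = m/n*n≤m n (suc d)

n<[1+⌊n/d⌋]*d : ∀ n d .{{_ : NonZero d}} → n < suc ⌊ n / d ⌋ * d
n<[1+⌊n/d⌋]*d n (suc d) = begin-strict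
  n                                ≡⟨ m≡m%n+[m/n]*n n (suc d) ⟩
  n % suc d + (n / suc d) * suc d  <⟨ +-monoˡ-< _ (m%n<n n (suc d)) ⟩
  suc d + (n / suc d) * suc d      ∎
  where open ≤-Reasoning

⌊n/d⌋≤n : ∀ n d → ⌊ n / d ⌋ ≤ n
⌊n/d⌋≤n n zero    = z≤n
⌊n/d⌋≤n n (suc d) = m/n≤m n (suc d)

⌊/⌋-antitone : ∀ n {d e} .{{_ : NonZero d}} → d ≤ e → ⌊ n / e ⌋ ≤ ⌊ n / d ⌋
⌊/⌋-antitone n {suc d} {suc e} d≤e = /-monoʳ-≤ n d≤e

⌊a*n/d⌋≤a*[1+⌊n/d⌋] : ∀ a n d .{{_ : NonZero d}} → ⌊ a * n / d ⌋ ≤ a * suc ⌊ n / d ⌋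
⌊a*n/d⌋≤a*[1+⌊n/d⌋] a n d = *-cancelʳ-≤ ⌊ a * n / d ⌋ (a * suc ⌊ n / d ⌋) d (begin
  ⌊ a * n / d ⌋ * d        ≤⟨ ⌊n/d⌋*d≤n (a * n) d ⟩
  a * n                    ≤⟨ *-monoʳ-≤ a (<⇒≤ (n<[1+⌊n/d⌋]*d n d)) ⟩
  a * (suc ⌊ n / d ⌋ * d)  ≡⟨ *-assoc a (suc ⌊ n / d ⌋) d ⟨
  a * suc ⌊ n / d ⌋ * d    ∎)
  where open ≤-Reasoning

m<2n⇒⌊m/2⌋<n : ∀ {m} n → m < 2 * n → ⌊ m /2⌋ < n
m<2n⇒⌊m/2⌋<n {m} n m<2n = *-cancelˡ-< 2 ⌊ m /2⌋ n (begin-strict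
  2 * ⌊ m /2⌋        ≡⟨ cong (_+_ ⌊ m /2⌋) (+-identityʳ ⌊ m /2⌋) ⟩
  ⌊ m /2⌋ + ⌊ m /2⌋  ≤⟨ +-monoʳ-≤ ⌊ m /2⌋ (⌊n/2⌋≤⌈n/2⌉ m) ⟩
  ⌊ m /2⌋ + ⌈ m /2⌉  ≡⟨ ⌊n/2⌋+⌈n/2⌉≡n m ⟩
  m                  <⟨ m<2n ⟩
  2 * n              ∎)
  where open ≤-Reasoning

2^[1+n]≡2^n+2^n : ∀ n → 2 ^ suc n ≡ 2 ^ n + 2 ^ n
2^[1+n]≡2^n+2^n n = cong (_+_ (2 ^ n)) (+-identityʳ (2 ^ n))

n<2^n : ∀ n → n < 2 ^ n
n<2^n zero    = z<s
n<2^n (suc n) = ≤-trans (+-mono-≤ (m^n>0 2 n) (n<2^n n)) (≤-reflexive (sym (2^[1+n]≡2^n+2^n n)))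

n<2^k⇒⌊log₂n⌋<k : ∀ k {n} .{{_ : NonZero n}} → n < 2 ^ k → ⌊log₂ n ⌋ < k
n<2^k⇒⌊log₂n⌋<k zero    {suc n}             (s≤s ())
n<2^k⇒⌊log₂n⌋<k (suc k) {1}                 _         = s≤s z≤n
n<2^k⇒⌊log₂n⌋<k (suc k) {n@(suc (suc _))} n<2^[1+k] = begin-strict
  ⌊log₂ n ⌋            ≡⟨ m+[n∸m]≡n (⌊log₂⌋-mono-≤ {2} {n} (s≤s (s≤s z≤n))) ⟨
  suc (⌊log₂ n ⌋ ∸ 1)  ≡⟨ cong suc (⌊log₂⌊n/2⌋⌋≡⌊log₂n⌋∸1 n) ⟨
  suc ⌊log₂ ⌊ n /2⌋ ⌋  <⟨ s≤s (n<2^k⇒⌊log₂n⌋<k k (m<2n⇒⌊m/2⌋<n (2 ^ k) n<2^[1+k])) ⟩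
  suc k                ∎
  where open ≤-Reasoning

2^⌊log₂n⌋≤n : ∀ n .{{_ : NonZero n}} → 2 ^ ⌊log₂ n ⌋ ≤ n
2^⌊log₂n⌋≤n n = ≮⇒≥ λ n<2^⌊log₂n⌋ →
  <-irrefl refl (n<2^k⇒⌊log₂n⌋<k ⌊log₂ n ⌋ n<2^⌊log₂n⌋)

n<2^[1+⌊log₂n⌋] : ∀ n → n < 2 ^ suc ⌊log₂ n ⌋
n<2^[1+⌊log₂n⌋] n = ≰⇒> λ 2^[1+⌊log₂n⌋]≤n → <-irrefl refl
  (subst (_≤ ⌊log₂ n ⌋) (⌊log₂[2^n]⌋≡n (suc ⌊log₂ n ⌋)) (⌊log₂⌋-mono-≤ 2^[1+⌊log₂n⌋]≤n))

2^j≤n<2^[1+j]⇒⌊log₂n⌋≡j : ∀ {j n} → 2 ^ j ≤ n → n < 2 ^ suc j → ⌊log₂ n ⌋ ≡ j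
2^j≤n<2^[1+j]⇒⌊log₂n⌋≡j {j} {n} 2^j≤n n<2^[1+j] = ≤-antisym
  (≤-pred (n<2^k⇒⌊log₂n⌋<k (suc j) {{>-nonZero (≤-trans (m^n>0 2 j) 2^j≤n)}} n<2^[1+j]))
  (subst (_≤ ⌊log₂ n ⌋) (⌊log₂[2^n]⌋≡n j) (⌊log₂⌋-mono-≤ 2^j≤n))

2^m≤2^n⇒m≤n : ∀ {m n} → 2 ^ m ≤ 2 ^ n → m ≤ n
2^m≤2^n⇒m≤n {m} {n} 2^m≤2^n =
  subst₂ _≤_ (⌊log₂[2^n]⌋≡n m) (⌊log₂[2^n]⌋≡n n) (⌊log₂⌋-mono-≤ 2^m≤2^n)

oddPrimeSum : (ℕ → ℕ) → ℕ → ℕ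
oddPrimeSum f zero    = 0
oddPrimeSum f (suc N) with prime? (suc N) | 2 <? suc N
... | yes _ | yes _ = oddPrimeSum f N + f (suc N)
... | _     | _     = oddPrimeSum f N

oddPrimeProduct : (ℕ → ℕ) → ℕ → ℕ
oddPrimeProduct f zero    = 1
oddPrimeProduct f (suc N) with prime? (suc N) | 2 <? suc N
... | yes _ | yes _ = oddPrimeProduct f N * f (suc N)
... | _     | _     = oddPrimeProduct f N

toℚᵘ-/ : ∀ i b .{{_ : NonZero b}} → toℚᵘ (i ℚ./ b) ≃ (i ℚᵘ./ b)
toℚᵘ-/ i (suc b) = ℚ.toℚᵘ-fromℚᵘ (mkℚᵘ i b)

/-cross-≡ : ∀ a b c d .{{_ : NonZero b}} .{{_ : NonZero d}} → a * d ≡ c * b → + a ℚ./ b ≡ + c ℚ./ d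
/-cross-≡ a b@(suc _) c d@(suc _) ad≡cb = ℚ.toℚᵘ-injective (ℚᵘ.≃-trans (toℚᵘ-/ (+ a) b)
  (ℚᵘ.≃-trans (*≡* (trans (sym (ℤ.pos-* a d)) (trans (cong +_ ad≡cb) (ℤ.pos-* c b))))
              (ℚᵘ.≃-sym (toℚᵘ-/ (+ c) d))))

/-cross-≤ : ∀ a b c d .{{_ : NonZero b}} .{{_ : NonZero d}} → a * d ≤ c * b → + a ℚ./ b ℚ.≤ + c ℚ./ d
/-cross-≤ a b@(suc _) c d@(suc _) ad≤cb = ℚ.toℚᵘ-cancel-≤
  (ℚᵘ.≤-respˡ-≃ (ℚᵘ.≃-sym (toℚᵘ-/ (+ a) b)) (ℚᵘ.≤-respʳ-≃ (ℚᵘ.≃-sym (toℚᵘ-/ (+ c) d))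
                (*≤* (subst₂ ℤ._≤_ (ℤ.pos-* a d) (ℤ.pos-* c b) (ℤ.+≤+ ad≤cb)))))

/-*-/ : ∀ a b c d .{{_ : NonZero b}} .{{_ : NonZero d}} →
  (+ a ℚ./ b) ℚ.* (+ c ℚ./ d) ≡ (+ (a * c) ℚ./ (b * d)) {{m*n≢0 b d}}
/-*-/ a b@(suc _) c d@(suc _) = ℚ.toℚᵘ-injective (ℚᵘ.≃-trans (ℚ.toℚᵘ-homo-* (+ a ℚ./ b) (+ c ℚ./ d))
  (ℚᵘ.≃-trans (ℚᵘ.*-cong (toℚᵘ-/ (+ a) b) (toℚᵘ-/ (+ c) d))
  (ℚᵘ.≃-trans (ℚᵘ.≃-reflexive (cong (ℚᵘ._/ (b * d)) (sym (ℤ.pos-* a c))))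
              (ℚᵘ.≃-sym (toℚᵘ-/ (+ (a * c)) (b * d))))))

/-+-/ : ∀ a b c d .{{_ : NonZero b}} .{{_ : NonZero d}} →
  (+ a ℚ./ b) ℚ.+ (+ c ℚ./ d) ≡ (+ (a * d + c * b) ℚ./ (b * d)) {{m*n≢0 b d}}
/-+-/ a b@(suc _) c d@(suc _) = ℚ.toℚᵘ-injective (ℚᵘ.≃-trans (ℚ.toℚᵘ-homo-+ (+ a ℚ./ b) (+ c ℚ./ d))
  (ℚᵘ.≃-trans (ℚᵘ.+-cong (toℚᵘ-/ (+ a) b) (toℚᵘ-/ (+ c) d))
  (ℚᵘ.≃-trans (ℚᵘ.≃-reflexive (cong (ℚᵘ._/ (b * d)) numerator))
              (ℚᵘ.≃-sym (toℚᵘ-/ (+ (a * d + c * b)) (b * d))))))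
  where
  numerator : + a ℤ.* + d ℤ.+ + c ℤ.* + b ≡ + (a * d + c * b)
  numerator = trans (cong₂ ℤ._+_ (sym (ℤ.pos-* a d)) (sym (ℤ.pos-* c b))) (sym (ℤ.pos-+ (a * d) (c * b)))

p∸2≢0 : ∀ {p} → 2 < p → NonZero (p ∸ 2)
p∸2≢0 2<p = >-nonZero (m<n⇒0<n∸m 2<p)

0≤eulerFactor : ∀ p → 0ℚ ℚ.≤ eulerFactor p
0≤eulerFactor (suc (suc (suc k))) = /-cross-≤ 0 1 (3 + k) (suc k) z≤n
0≤eulerFactor 0                   = /-cross-≤ 0 1 1 1 z≤n
0≤eulerFactor 1                   = /-cross-≤ 0 1 1 1 z≤n
0≤eulerFactor 2                   = /-cross-≤ 0 1 1 1 z≤n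

/-*-eulerFactor : ∀ a b p .{{b≢0 : NonZero b}} (2<p : 2 < p) →
  (+ a ℚ./ b) ℚ.* eulerFactor p ≡ (+ (a * p) ℚ./ (b * (p ∸ 2))) {{m*n≢0 b (p ∸ 2) {{b≢0}} {{p∸2≢0 2<p}}}}
/-*-eulerFactor a b (suc (suc (suc k))) _ = /-*-/ a b (3 + k) (suc k)
/-*-eulerFactor a b 1 (s≤s ())
/-*-eulerFactor a b 2 (s≤s (s≤s ()))

∏[p∸2]≢0 : ∀ N → NonZero (oddPrimeProduct (_∸ 2) N)
∏[p∸2]≢0 zero    = _
∏[p∸2]≢0 (suc N) with prime? (suc N) | 2 <? suc N
... | yes _ | yes 2<1+N = m*n≢0 _ _ {{∏[p∸2]≢0 N}} {{p∸2≢0 2<1+N}}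
... | yes _ | no _      = ∏[p∸2]≢0 N
... | no _  | _         = ∏[p∸2]≢0 N

prodFactor≡∏p/∏[p∸2] : ∀ N →
  prodFactor N ≡ (+ oddPrimeProduct (λ p → p) N ℚ./ oddPrimeProduct (_∸ 2) N) {{∏[p∸2]≢0 N}}
prodFactor≡∏p/∏[p∸2] zero    = refl
prodFactor≡∏p/∏[p∸2] (suc N) with prime? (suc N) | 2 <? suc N
... | yes _ | yes 2<1+N = trans (cong (ℚ._* eulerFactor (suc N)) (prodFactor≡∏p/∏[p∸2] N))
  (/-*-eulerFactor (oddPrimeProduct (λ p → p) N) (oddPrimeProduct (_∸ 2) N) (suc N) {{∏[p∸2]≢0 N}} 2<1+N)
... | yes _ | no _      = prodFactor≡∏p/∏[p∸2] N
... | no _  | _         = prodFactor≡∏p/∏[p∸2] N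

0≤prodFactor : ∀ N → 0ℚ ℚ.≤ prodFactor N
0≤prodFactor N = subst (0ℚ ℚ.≤_) (sym (prodFactor≡∏p/∏[p∸2] N))
  (/-cross-≤ 0 1 (oddPrimeProduct (λ p → p) N) (oddPrimeProduct (_∸ 2) N) {{_}} {{∏[p∸2]≢0 N}} z≤n)

-- The Euler-product bound

prime⇒2≤ : ∀ {p} → Prime p → 2 ≤ p
prime⇒2≤ {p} pp = nonTrivial⇒n>1 p {{prime⇒nonTrivial pp}}

Ω≡length : ∀ n .{{_ : NonZero n}} (f : PrimeFactorisation n) → Ω n ≡ length (PrimeFactorisation.factors f)
Ω≡length (suc n) f = ↭-length (factorisationUnique (factorise (suc n)) f)

Ω[p*z]≡1+Ωz : ∀ {p} z .{{_ : NonZero z}} → Prime p → Ω (p * z) ≡ suc (Ω z)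
Ω[p*z]≡1+Ωz {p@(suc _)} z@(suc _) pp = trans (Ω≡length (p * z) p∷fz) (cong suc (sym (Ω≡length z fz)))
  where
  open PrimeFactorisation
  fz = factorise z
  p∷fz : PrimeFactorisation (p * z)
  p∷fz = record
    { factors         = p ∷ factors fz
    ; isFactorisation = cong (p *_) (isFactorisation fz)
    ; factorsPrime    = pp ∷ factorsPrime fz
    }

term[p*z]≡2/p*term[z] : ∀ {p} z (pp : Prime p) → term (p * z) ≡ (+ 2 ℚ./ p) {{prime⇒nonZero pp}} ℚ.* term z
term[p*z]≡2/p*term[z] {p@(suc _)} zero      _  = trans (cong term (*-zeroʳ p)) (sym (ℚ.*-zeroʳ (+ 2 ℚ./ p)))
term[p*z]≡2/p*term[z] {p@(suc _)} z@(suc _) pp =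
  trans (cong (λ k → + (2 ^ k) ℚ./ (p * z)) (Ω[p*z]≡1+Ωz z pp)) (sym (/-*-/ 2 p (2 ^ Ω z) z))

term[2^k*m]≡term[m] : ∀ k m → term (2 ^ k * m) ≡ term m
term[2^k*m]≡term[m] zero    m = cong term (+-identityʳ m)
term[2^k*m]≡term[m] (suc k) m = begin
  term (2 * 2 ^ k * m)          ≡⟨ cong term (*-assoc 2 (2 ^ k) m) ⟩
  term (2 * (2 ^ k * m))        ≡⟨ term[p*z]≡2/p*term[z] (2 ^ k * m) prime[2] ⟩
  1ℚ ℚ.* term (2 ^ k * m)       ≡⟨ ℚ.*-identityˡ (term (2 ^ k * m)) ⟩
  term (2 ^ k * m)              ≡⟨ term[2^k*m]≡term[m] k m ⟩
  term m                        ∎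
  where open ≡-Reasoning

1+[2/p]*eulerFactor≡eulerFactor : ∀ p (2<p : 2 < p) →
  1ℚ ℚ.+ (+ 2 ℚ./ p) {{>-nonZero (<-trans z<s 2<p)}} ℚ.* eulerFactor p ≡ eulerFactor p
1+[2/p]*eulerFactor≡eulerFactor (suc (suc (suc k))) _ = begin
  1ℚ ℚ.+ (+ 2 ℚ./ (3 + k)) ℚ.* (+ (3 + k) ℚ./ suc k)  ≡⟨ cong (ℚ._+_ 1ℚ) (/-*-/ 2 (3 + k) (3 + k) (suc k)) ⟩
  1ℚ ℚ.+ + (2 * (3 + k)) ℚ./ ((3 + k) * suc k)       ≡⟨ /-+-/ 1 1 (2 * (3 + k)) ((3 + k) * suc k) ⟩
  + (1 * D + 2 * (3 + k) * 1) ℚ./ (1 * D)             ≡⟨ /-cross-≡ (1 * D + 2 * (3 + k) * 1) (1 * D) (3 + k) (suc k)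
                                                                   (cross k) ⟩
  + (3 + k) ℚ./ suc k                                 ∎
  where
  open ≡-Reasoning
  D = (3 + k) * suc k
  cross : ∀ k → (1 * ((3 + k) * suc k) + 2 * (3 + k) * 1) * suc k ≡ (3 + k) * (1 * ((3 + k) * suc k))
  cross = solve-∀
1+[2/p]*eulerFactor≡eulerFactor 1 (s≤s ())
1+[2/p]*eulerFactor≡eulerFactor 2 (s≤s (s≤s ()))

termSum : List ℕ → ℚ
termSum ys = sumℚ (map term ys)

termSum-partition : ∀ {P : ℕ → Set} (P? : Decidable P) ys →
  termSum ys ≡ termSum (filter (∁? P?) ys) ℚ.+ termSum (filter P? ys)
termSum-partition P? []       = refl
termSum-partition P? (y ∷ ys) with P? y
... | yes _ = trans (cong (ℚ._+_ (term y)) (termSum-partition P? ys))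
                    (x+[a+b]≡a+[x+b] (term y) (termSum (filter (∁? P?) ys)) (termSum (filter P? ys)))
  where
  x+[a+b]≡a+[x+b] : ∀ x a b → x ℚ.+ (a ℚ.+ b) ≡ a ℚ.+ (x ℚ.+ b)
  x+[a+b]≡a+[x+b] x a b = trans (sym (ℚ.+-assoc x a b)) (trans (cong (ℚ._+ b) (ℚ.+-comm x a)) (ℚ.+-assoc a x b))
... | no _  = trans (cong (ℚ._+_ (term y)) (termSum-partition P? ys))
                    (sym (ℚ.+-assoc (term y) (termSum (filter (∁? P?) ys)) (termSum (filter P? ys))))

termSum-multiples : ∀ {p} (pp : Prime p) ms → All (p ∣_) ms →
  termSum ms ≡ (+ 2 ℚ./ p) {{prime⇒nonZero pp}} ℚ.* termSum (map (λ m → (m / p) {{prime⇒nonZero pp}}) ms)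
termSum-multiples {p} pp []       []             = sym (ℚ.*-zeroʳ ((+ 2 ℚ./ p) {{prime⇒nonZero pp}}))
termSum-multiples {p} pp (m ∷ ms) (p∣m ∷ p∣ms) = begin
  term m ℚ.+ termSum ms                      ≡⟨ cong₂ ℚ._+_ term[m]≡c*term[m/p] (termSum-multiples pp ms p∣ms) ⟩
  c ℚ.* term (m / p) ℚ.+ c ℚ.* termSum qs    ≡⟨ ℚ.*-distribˡ-+ c (term (m / p)) (termSum qs) ⟨
  c ℚ.* (term (m / p) ℚ.+ termSum qs)        ∎
  where
  open ≡-Reasoning
  instance _ = prime⇒nonZero pp
  c = + 2 ℚ./ p
  qs = map (_/ p) ms
  term[m]≡c*term[m/p] : term m ≡ c ℚ.* term (m / p)
  term[m]≡c*term[m/p] = trans (cong term (sym (m*[n/m]≡n p∣m))) (term[p*z]≡2/p*term[z] (m / p) pp)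

Unique-map⁺ : ∀ {P : ℕ → Set} {f : ℕ → ℕ} → (∀ {x y} → P x → P y → f x ≡ f y → x ≡ y) →
  ∀ {xs} → All P xs → Unique xs → Unique (map f xs)
Unique-map⁺ inj []         []          = []
Unique-map⁺ inj (px ∷ pxs) (x∉ ∷ uxs) =
  Allₚ.map⁺ (All.zipWith (λ (x≢y , py) fx≡fy → x≢y (inj px py fx≡fy)) (x∉ , pxs)) ∷ Unique-map⁺ inj pxs uxs

OddSmooth : ℕ → ℕ → Set
OddSmooth N y = 0 < y × ¬ 2 ∣ y × Smooth N y

OddSmooth-pred : ∀ {N y} → (∀ q → Prime q → q ∣ y → q ≢ suc N) → OddSmooth (suc N) y → OddSmooth N y
OddSmooth-pred q≢1+N (0<y , odd , smooth) =
  0<y , odd , λ q pq q∣y → ≤-pred (≤∧≢⇒< (smooth q pq q∣y) (q≢1+N q pq q∣y))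

OddSmooth-∣ : ∀ {N x y} → 0 < x → x ∣ y → OddSmooth N y → OddSmooth N x
OddSmooth-∣ 0<x x∣y (_ , odd , smooth) =
  0<x , (λ 2∣x → odd (∣-trans 2∣x x∣y)) , λ q pq q∣x → smooth q pq (∣-trans q∣x x∣y)

OddSmooth-/ : ∀ {N p y} .{{_ : NonZero p}} → 1 < p → p ∣ y → OddSmooth N y → OddSmooth N (y / p) × y / p < y
OddSmooth-/ {N} {p} {y} 1<p p∣y smooth@(0<y , _) =
  OddSmooth-∣ 0<y/p y/p∣y smooth , m/n<m y p {{>-nonZero 0<y}} 1<p
  where
  0<y/p : 0 < y / p
  0<y/p = m≥n⇒m/n>0 (∣⇒≤ {{>-nonZero 0<y}} p∣y)
  y/p∣y : y / p ∣ y
  y/p∣y = divides p (sym (m*[n/m]≡n p∣y))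

OddSmooth[0]⇒≡1 : ∀ {y} → OddSmooth 0 y → y ≡ 1
OddSmooth[0]⇒≡1 {y@(suc _)} (_ , _ , smooth) with factorise y
... | record { factors = [] ; isFactorisation = y≡1 } = y≡1
... | record { factors = p ∷ ps ; isFactorisation = y≡p*∏ps ; factorsPrime = pp ∷ _ } =
  ⊥-elim (<⇒≱ (prime⇒2≤ pp) (≤-trans (smooth p pp (divides (product ps) (trans y≡p*∏ps (*-comm p _)))) z≤n))

euler-base : ∀ ys → Unique ys → All (OddSmooth 0) ys → termSum ys ℚ.≤ 1ℚ
euler-base ys uys smooth = bound ys uys (All.map OddSmooth[0]⇒≡1 smooth)
  where
  bound : ∀ ys → Unique ys → All (_≡ 1) ys → termSum ys ℚ.≤ 1ℚ
  bound []          _               _                 = /-cross-≤ 0 1 1 1 z≤n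
  bound (_ ∷ [])    _               (refl ∷ [])       = ℚ.≤-reflexive (ℚ.+-identityʳ 1ℚ)
  bound (_ ∷ _ ∷ _) ((1≢1 ∷ _) ∷ _) (refl ∷ refl ∷ _) = ⊥-elim (1≢1 refl)

nonMultiples-OddSmooth : ∀ {N} ys → All (OddSmooth (suc N)) ys → All (OddSmooth N) (filter (∁? (suc N ∣?_)) ys)
nonMultiples-OddSmooth {N} ys smooth = All.zipWith
  (λ (p∤y , s) → OddSmooth-pred (λ q _ q∣y q≡p → p∤y (subst (_∣ _) q≡p q∣y)) s)
  (Allₚ.all-filter (∁? (suc N ∣?_)) ys , Allₚ.filter⁺ (∁? (suc N ∣?_)) smooth)

quotients-Unique : ∀ {p} .{{_ : NonZero p}} ys → Unique ys → Unique (map (_/ p) (filter (p ∣?_) ys))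
quotients-Unique {p} ys uys = Unique-map⁺ y/p-injective (Allₚ.all-filter (p ∣?_) ys) (Uniqueₚ.filter⁺ (p ∣?_) uys)
  where
  y/p-injective : ∀ {x y} → p ∣ x → p ∣ y → x / p ≡ y / p → x ≡ y
  y/p-injective p∣x p∣y x/p≡y/p = trans (sym (m*[n/m]≡n p∣x)) (trans (cong (p *_) x/p≡y/p) (m*[n/m]≡n p∣y))

quotients-OddSmooth : ∀ {N p B} .{{_ : NonZero p}} → 1 < p → ∀ ys → All (λ y → OddSmooth N y × y ≤ suc B) ys →
  All (λ q → OddSmooth N q × q ≤ B) (map (_/ p) (filter (p ∣?_) ys))
quotients-OddSmooth {p = p} 1<p ys bounded = Allₚ.map⁺ (All.zipWith divide
  (Allₚ.all-filter (p ∣?_) ys , Allₚ.filter⁺ (p ∣?_) bounded))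
  where
  divide : ∀ {N B y} → p ∣ y × (OddSmooth N y × y ≤ suc B) → OddSmooth N (y / p) × y / p ≤ B
  divide (p∣y , smooth , y≤1+B) with OddSmooth-/ 1<p p∣y smooth
  ... | smooth′ , y/p<y = smooth′ , ≤-pred (<-≤-trans y/p<y y≤1+B)

-- Elements are bounded by B so that the recursion on the quotients y / p terminates.
euler-step : ∀ {N X} → Prime (suc N) → 2 < suc N → 0ℚ ℚ.≤ X →
  (∀ ys → Unique ys → All (OddSmooth N) ys → termSum ys ℚ.≤ X) →
  ∀ ys → Unique ys → All (OddSmooth (suc N)) ys → termSum ys ℚ.≤ X ℚ.* eulerFactor (suc N)
euler-step {N} {X} pp 2<p 0≤X below ys uys smooth =
  bounded (product ys) ys uys (All.zip (smooth , All.tabulate (∈⇒≤product ys≢0)))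
  where
  p = suc N
  c = + 2 ℚ./ p
  E = eulerFactor p
  ys≢0 : All NonZero ys
  ys≢0 = All.map (λ (0<y , _) → >-nonZero 0<y) smooth
  0≤X*E : 0ℚ ℚ.≤ X ℚ.* E
  0≤X*E = ℚ.nonNegative⁻¹ (X ℚ.* E)
    {{ℚ.nonNeg*nonNeg⇒nonNeg X {{ℚ.nonNegative 0≤X}} E {{ℚ.nonNegative (0≤eulerFactor p)}}}}
  X+c*[X*E]≡X*E : X ℚ.+ c ℚ.* (X ℚ.* E) ≡ X ℚ.* E
  X+c*[X*E]≡X*E = begin
    X ℚ.+ c ℚ.* (X ℚ.* E)         ≡⟨ cong (ℚ._+_ X) (trans (sym (ℚ.*-assoc c X E))
                                       (trans (cong (ℚ._* E) (ℚ.*-comm c X)) (ℚ.*-assoc X c E))) ⟩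
    X ℚ.+ X ℚ.* (c ℚ.* E)         ≡⟨ cong (ℚ._+ X ℚ.* (c ℚ.* E)) (ℚ.*-identityʳ X) ⟨
    X ℚ.* 1ℚ ℚ.+ X ℚ.* (c ℚ.* E)  ≡⟨ ℚ.*-distribˡ-+ X 1ℚ (c ℚ.* E) ⟨
    X ℚ.* (1ℚ ℚ.+ c ℚ.* E)        ≡⟨ cong (ℚ._*_ X) (1+[2/p]*eulerFactor≡eulerFactor p 2<p) ⟩
    X ℚ.* E                       ∎
    where open ≡-Reasoning
  bounded : ∀ B ys → Unique ys → All (λ y → OddSmooth p y × y ≤ B) ys → termSum ys ℚ.≤ X ℚ.* E
  bounded zero    []      _   _                       = 0≤X*E
  bounded zero    (_ ∷ _) _   (((0<y , _) , y≤0) ∷ _) = ⊥-elim (<⇒≱ 0<y y≤0)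
  bounded (suc B) ys      uys ys≤1+B = begin
    termSum ys                     ≡⟨ termSum-partition (p ∣?_) ys ⟩
    termSum R ℚ.+ termSum M        ≡⟨ cong (ℚ._+_ (termSum R))
                                           (termSum-multiples pp M (Allₚ.all-filter (p ∣?_) ys)) ⟩
    termSum R ℚ.+ c ℚ.* termSum Q  ≤⟨ ℚ.+-mono-≤ (below R (Uniqueₚ.filter⁺ (∁? (p ∣?_)) uys) R-smooth)
                                                 (ℚ.*-monoˡ-≤-nonNeg c {{ℚ.normalize-nonNeg 2 p}}
                                                   (bounded B Q (quotients-Unique ys uys) Q-bounded)) ⟩
    X ℚ.+ c ℚ.* (X ℚ.* E)          ≡⟨ X+c*[X*E]≡X*E ⟩
    X ℚ.* E                        ∎
    where
    open ℚ.≤-Reasoning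
    R = filter (∁? (p ∣?_)) ys
    M = filter (p ∣?_) ys
    Q = map (_/ p) M
    R-smooth : All (OddSmooth N) R
    R-smooth = nonMultiples-OddSmooth ys (All.map proj₁ ys≤1+B)
    Q-bounded : All (λ q → OddSmooth p q × q ≤ B) Q
    Q-bounded = quotients-OddSmooth (<-trans (s≤s (s≤s z≤n)) 2<p) ys ys≤1+B

euler-product : ∀ N ys → Unique ys → All (OddSmooth N) ys → termSum ys ℚ.≤ prodFactor N
euler-product zero    = euler-base
euler-product (suc N) ys uys smooth with prime? (suc N) | 2 <? suc N
... | yes pp | yes 2<p = euler-step pp 2<p (0≤prodFactor N) (euler-product N) ys uys smooth
... | yes _  | no 2≮p  = euler-product N ys uys (All.map (λ s → OddSmooth-pred (odd⇒q≢1+N s) s) smooth)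
  where
  odd⇒q≢1+N : ∀ {y} → OddSmooth (suc N) y → ∀ q → Prime q → q ∣ y → q ≢ suc N
  odd⇒q≢1+N (_ , odd , _) q pq q∣y q≡1+N =
    odd (subst (_∣ _) (≤-antisym (subst (_≤ 2) (sym q≡1+N) (≮⇒≥ 2≮p)) (prime⇒2≤ pq)) q∣y)
... | no ¬pp | _       =
  euler-product N ys uys (All.map (OddSmooth-pred (λ q pq _ q≡1+N → ¬pp (subst Prime q≡1+N pq))) smooth)

record TwoAdic (a : ℕ) : Set where
  constructor mkTwoAdic
  field
    exponent : ℕ
    oddPart  : ℕ
    a≡2^k*m  : a ≡ 2 ^ exponent * oddPart
    odd      : ¬ 2 ∣ oddPart

twoAdic : ∀ a → 0 < a → TwoAdic a
twoAdic = <-rec (λ a → 0 < a → TwoAdic a) halve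
  where
  halve : ∀ a → (∀ {b} → b < a → 0 < b → TwoAdic b) → 0 < a → TwoAdic a
  halve a rec 0<a with 2 ∣? a
  ... | no 2∤a = mkTwoAdic 0 a (sym (+-identityʳ a)) 2∤a
  ... | yes (divides q refl) with rec q<q*2 0<q
    where
    0<q : 0 < q
    0<q = >-nonZero⁻¹ q {{m*n≢0⇒m≢0 q {{>-nonZero 0<a}}}}
    q<q*2 : q < q * 2
    q<q*2 = m<m*n q 2 {{>-nonZero 0<q}} (s≤s (s≤s z≤n))
  ...   | mkTwoAdic k m q≡2^k*m odd = mkTwoAdic (suc k) m (trans (cong (_* 2) q≡2^k*m) (rearrange (2 ^ k) m)) odd
    where
    rearrange : ∀ x m → x * m * 2 ≡ 2 * x * m
    rearrange = solve-∀

-- oddPart 0 = 0 is a junk value; only positive arguments occur.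
oddPart : ℕ → ℕ
oddPart zero      = 0
oddPart a@(suc _) = TwoAdic.oddPart (twoAdic a z<s)

term∘oddPart : ∀ a → term (oddPart a) ≡ term a
term∘oddPart zero      = refl
term∘oddPart a@(suc _) with twoAdic a z<s
... | mkTwoAdic k m a≡2^k*m _ = sym (trans (cong term a≡2^k*m) (term[2^k*m]≡term[m] k m))

termSum∘oddPart : ∀ xs → termSum (map oddPart xs) ≡ termSum xs
termSum∘oddPart xs = cong sumℚ (trans (sym (map-∘ xs)) (map-cong term∘oddPart xs))

oddPart-OddSmooth : ∀ {N a} → 0 < a → Smooth N a → OddSmooth N (oddPart a)
oddPart-OddSmooth {N} {a@(suc _)} _ smooth with twoAdic a z<s
... | mkTwoAdic k m a≡2^k*m odd =
  0<m , odd , λ q pq q∣m → smooth q pq (subst (q ∣_) (sym a≡2^k*m) (∣n⇒∣m*n (2 ^ k) q∣m))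
  where
  0<m : 0 < m
  0<m = >-nonZero⁻¹ m {{m*n≢0⇒n≢0 (2 ^ k) {{subst NonZero a≡2^k*m _}}}}

2^i*m∣2^j*m : ∀ {i j} m → i ≤ j → 2 ^ i * m ∣ 2 ^ j * m
2^i*m∣2^j*m {i} {j} m i≤j = *-monoˡ-∣ m (divides (2 ^ (j ∸ i))
  (trans (cong (2 ^_) (sym (m∸n+n≡m i≤j))) (^-distribˡ-+-* 2 (j ∸ i) i)))

-- Of two numbers with the same odd part, the one with fewer factors 2 divides the other.
oddPart-injective : ∀ {A : ℕ → Set} → Primitive A → ∀ {a b} → A a × 0 < a → A b × 0 < b →
  oddPart a ≡ oddPart b → a ≡ b
oddPart-injective A-primitive {a@(suc _)} {b@(suc _)} (Aa , _) (Ab , _) m≡m′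
  with twoAdic a z<s | twoAdic b z<s
... | mkTwoAdic i m a≡2^i*m _ | mkTwoAdic j m′ b≡2^j*m′ _ with ≤-total i j
...   | inj₁ i≤j = A-primitive a b Aa Ab
  (subst₂ _∣_ (sym a≡2^i*m) (trans (cong (2 ^ j *_) m≡m′) (sym b≡2^j*m′)) (2^i*m∣2^j*m m i≤j))
...   | inj₂ j≤i = sym (A-primitive b a Ab Aa
  (subst₂ _∣_ (sym b≡2^j*m′) (trans (cong (2 ^ i *_) (sym m≡m′)) (sym a≡2^i*m)) (2^i*m∣2^j*m m′ j≤i)))

primitive-sum≤prodFactor : ∀ (A : ℕ → Set) → (∀ a → A a → 1 ≤ a) → Primitive A → ∀ N xs →
  Unique xs → All (λ a → A a × Smooth N a) xs → sumℚ (map term xs) ℚ.≤ prodFactor N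
primitive-sum≤prodFactor A positive A-primitive N xs uxs As = subst (ℚ._≤ prodFactor N) (termSum∘oddPart xs)
  (euler-product N (map oddPart xs) (Unique-map⁺ (oddPart-injective A-primitive) A⁺ uxs)
    (Allₚ.map⁺ (All.zipWith (λ ((_ , 0<a) , (_ , smooth)) → oddPart-OddSmooth 0<a smooth) (A⁺ , As))))
  where
  A⁺ : All (λ a → A a × 0 < a) xs
  A⁺ = All.map (λ (Aa , _) → Aa , positive _ Aa) As

-- Chebyshev and Mertens bounds, with weights ⌊log₂ p⌋

prime∣prime⇒≡ : ∀ {p q} → Prime p → Prime q → p ∣ q → p ≡ q
prime∣prime⇒≡ pp pq p∣q with prime⇒irreducible pq p∣q
... | inj₁ refl = ⊥-elim (<-irrefl refl (prime⇒2≤ pp))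
... | inj₂ p≡q  = p≡q

prime∣n!⇒≤ : ∀ {p} n → Prime p → p ∣ n ! → p ≤ n
prime∣n!⇒≤ zero    pp p∣1 = ⊥-elim (<-irrefl (sym (∣1⇒≡1 p∣1)) (prime⇒2≤ pp))
prime∣n!⇒≤ (suc n) pp p∣n! with euclidsLemma (suc n) (n !) pp p∣n!
... | inj₁ p∣1+n = ∣⇒≤ p∣1+n
... | inj₂ p∣n!  = m≤n⇒m≤1+n (prime∣n!⇒≤ n pp p∣n!)

θ : ℕ → ℕ
θ y = ∑[ p < y ] when (prime? p) ⌊log₂ p ⌋

θ∣ : ℕ → ℕ → ℕ
θ∣ y m = ∑[ p < y ] when (prime? p) (when (p ∣? m) ⌊log₂ p ⌋)

θ∣[q*m]≡θ∣[m] : ∀ y {q} m → Prime q → y ≤ q → θ∣ y (q * m) ≡ θ∣ y m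
θ∣[q*m]≡θ∣[m] y {q} m pq y≤q = ∑-cong y termwise
  where
  termwise : ∀ p → p < y →
    when (prime? p) (when (p ∣? q * m) ⌊log₂ p ⌋) ≡ when (prime? p) (when (p ∣? m) ⌊log₂ p ⌋)
  termwise p p<y with prime? p
  ... | no _   = refl
  ... | yes pp with p ∣? q * m | p ∣? m
  ...   | yes _    | yes _   = refl
  ...   | no _     | no _    = refl
  ...   | no p∤qm  | yes p∣m = ⊥-elim (p∤qm (∣n⇒∣m*n q p∣m))
  ...   | yes p∣qm | no p∤m  with euclidsLemma q m pp p∣qm
  ...     | inj₁ p∣q = ⊥-elim (<-irrefl (prime∣prime⇒≡ pp pq p∣q) (<-≤-trans p<y y≤q))
  ...     | inj₂ p∣m = ⊥-elim (p∤m p∣m)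

2^θ∣≤ : ∀ y m .{{_ : NonZero m}} → 2 ^ θ∣ y m ≤ m
2^θ∣≤ zero    m = >-nonZero⁻¹ m
2^θ∣≤ (suc y) m with prime? y
... | no _ = subst (λ t → 2 ^ t ≤ m) (sym (+-identityʳ (θ∣ y m))) (2^θ∣≤ y m)
... | yes py with y ∣? m
...   | no _ = subst (λ t → 2 ^ t ≤ m) (sym (+-identityʳ (θ∣ y m))) (2^θ∣≤ y m)
...   | yes (divides q refl) = begin
  2 ^ (θ∣ y (q * y) + ⌊log₂ y ⌋)    ≡⟨ ^-distribˡ-+-* 2 (θ∣ y (q * y)) ⌊log₂ y ⌋ ⟩
  2 ^ θ∣ y (q * y) * 2 ^ ⌊log₂ y ⌋  ≡⟨ cong (λ t → 2 ^ t * 2 ^ ⌊log₂ y ⌋) θ∣[q*y]≡θ∣[q] ⟩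
  2 ^ θ∣ y q * 2 ^ ⌊log₂ y ⌋        ≤⟨ *-mono-≤ (2^θ∣≤ y q) (2^⌊log₂n⌋≤n y {{prime⇒nonZero py}}) ⟩
  q * y                             ∎
  where
  open ≤-Reasoning
  instance
    _ : NonZero q
    _ = m*n≢0⇒m≢0 q
  θ∣[q*y]≡θ∣[q] : θ∣ y (q * y) ≡ θ∣ y q
  θ∣[q*y]≡θ∣[q] = trans (cong (θ∣ y) (*-comm q y)) (θ∣[q*m]≡θ∣[m] y q py ≤-refl)

multiples : ℕ → ℕ → ℕ
multiples d n = ∑[ k < n ] when (d ∣? suc k) 1

n<[1+multiples]*d : ∀ d n .{{_ : NonZero d}} → n < suc (multiples d n) * d
n<[1+multiples]*d d zero    = subst (0 <_) (sym (*-identityˡ d)) (>-nonZero⁻¹ d)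
n<[1+multiples]*d d (suc n) with d ∣? suc n
... | yes _    = subst (λ c → suc n < suc c * d) (+-comm 1 (multiples d n))
  (<-≤-trans (s≤s (n<[1+multiples]*d d n)) (+-monoˡ-≤ (suc (multiples d n) * d) (>-nonZero⁻¹ d)))
... | no d∤1+n = subst (λ c → suc n < suc c * d) (sym (+-identityʳ (multiples d n)))
  (≤∧≢⇒< (n<[1+multiples]*d d n) (λ 1+n≡[1+c]*d → d∤1+n (divides (suc (multiples d n)) 1+n≡[1+c]*d)))

⌊n/d⌋≤multiples : ∀ n d .{{_ : NonZero d}} → ⌊ n / d ⌋ ≤ multiples d n
⌊n/d⌋≤multiples n d@(suc _) = ≤-pred (m<n*o⇒m/o<n (n<[1+multiples]*d d n))

∑θ∣≡∑multiples : ∀ y n →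
  ∑[ k < n ] θ∣ y (suc k) ≡ ∑[ p < y ] (⌊log₂ p ⌋ * when (prime? p) (multiples p n))
∑θ∣≡∑multiples y n = trans (∑-comm n y _) (∑-cong y (λ p _ → column p))
  where
  column : ∀ p →
    ∑[ k < n ] when (prime? p) (when (p ∣? suc k) ⌊log₂ p ⌋) ≡ ⌊log₂ p ⌋ * when (prime? p) (multiples p n)
  column p with prime? p
  ... | no _  = trans (∑-const n 0) (trans (*-zeroʳ n) (sym (*-zeroʳ ⌊log₂ p ⌋)))
  ... | yes _ = trans (∑-cong n (λ k _ → when≡*when1 (p ∣? suc k) ⌊log₂ p ⌋))
                      (∑-distribˡ-* n ⌊log₂ p ⌋ (λ k → when (p ∣? suc k) 1))

⌊_/_⌋ₚ : ℕ → ℕ → ℕ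
⌊ n / p ⌋ₚ = when (prime? p) ⌊ n / p ⌋

mertens : ∀ y n L → n ≤ 2 ^ L → ∑[ p < y ] (⌊log₂ p ⌋ * ⌊ n / p ⌋ₚ) ≤ n * L
mertens y n L n≤2^L = begin
  ∑[ p < y ] (⌊log₂ p ⌋ * ⌊ n / p ⌋ₚ)                       ≤⟨ ∑-mono-≤ y ⌊log₂p⌋*⌊n/p⌋ₚ≤ ⟩
  ∑[ p < y ] (⌊log₂ p ⌋ * when (prime? p) (multiples p n))  ≡⟨ ∑θ∣≡∑multiples y n ⟨
  ∑[ k < n ] θ∣ y (suc k)                                  ≤⟨ ∑-mono-≤ n θ∣[1+k]≤L ⟩
  ∑[ _ < n ] L                                             ≡⟨ ∑-const n L ⟩
  n * L                                                    ∎
  where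
  open ≤-Reasoning
  ⌊log₂p⌋*⌊n/p⌋ₚ≤ : ∀ p → p < y → ⌊log₂ p ⌋ * ⌊ n / p ⌋ₚ ≤ ⌊log₂ p ⌋ * when (prime? p) (multiples p n)
  ⌊log₂p⌋*⌊n/p⌋ₚ≤ p _ with prime? p
  ... | no _   = ≤-refl
  ... | yes pp = *-monoʳ-≤ ⌊log₂ p ⌋ (⌊n/d⌋≤multiples n p {{prime⇒nonZero pp}})
  θ∣[1+k]≤L : ∀ k → k < n → θ∣ y (suc k) ≤ L
  θ∣[1+k]≤L k k<n = 2^m≤2^n⇒m≤n (≤-trans (2^θ∣≤ y (suc k)) (≤-trans k<n n≤2^L))

nCk≤2^n : ∀ n k → n C k ≤ 2 ^ n
nCk≤2^n n       zero    = m^n>0 2 n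
nCk≤2^n zero    (suc k) = z≤n
nCk≤2^n (suc n) (suc k) = begin
  suc n C suc k      ≡⟨ nCk+nC[k+1]≡[n+1]C[k+1] n k ⟨
  n C k + n C suc k  ≤⟨ +-mono-≤ (nCk≤2^n n k) (nCk≤2^n n (suc k)) ⟩
  2 ^ n + 2 ^ n      ≡⟨ 2^[1+n]≡2^n+2^n n ⟨
  2 ^ suc n          ∎
  where open ≤-Reasoning

nCk*k!*[n∸k]!≡n! : ∀ {n k} → k ≤ n → (n C k) * (k ! * (n ∸ k) !) ≡ n !
nCk*k!*[n∸k]!≡n! {n} {k} k≤n =
  trans (cong (_* (k ! * (n ∸ k) !)) (nCk≡n!/k![n-k]! k≤n)) (m/n*n≡m (k![n∸k]!∣n! k≤n))
  where instance _ = k !* (n ∸ k) !≢0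

[2m]Cm*m!*m!≡[2m]! : ∀ m → ((2 * m) C m) * (m ! * m !) ≡ (2 * m) !
[2m]Cm*m!*m!≡[2m]! m =
  subst (λ k → ((2 * m) C m) * (m ! * k !) ≡ (2 * m) !) 2m∸m≡m (nCk*k!*[n∸k]!≡n! (m≤n*m m 2))
  where
  2m∸m≡m : 2 * m ∸ m ≡ m
  2m∸m≡m = trans (cong (λ k → m + k ∸ m) (+-identityʳ m)) (m+n∸m≡n m m)

n∣n! : ∀ n .{{_ : NonZero n}} → n ∣ n !
n∣n! (suc n) = m∣m*n (n !)

prime∣[2m]Cm : ∀ {m p} → Prime p → m < p → p ≤ 2 * m → p ∣ (2 * m) C m
prime∣[2m]Cm {m} {p} pp m<p p≤2m with euclidsLemma ((2 * m) C m) (m ! * m !) pp p∣B*m!*m!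
  where
  p∣B*m!*m! : p ∣ ((2 * m) C m) * (m ! * m !)
  p∣B*m!*m! = subst (p ∣_) (sym ([2m]Cm*m!*m!≡[2m]! m))
    (∣-trans (n∣n! p {{prime⇒nonZero pp}}) (m≤n⇒m!∣n! p≤2m))
... | inj₁ p∣B     = p∣B
... | inj₂ p∣m!*m! with euclidsLemma (m !) (m !) pp p∣m!*m!
...   | inj₁ p∣m! = ⊥-elim (<⇒≱ m<p (prime∣n!⇒≤ m pp p∣m!))
...   | inj₂ p∣m! = ⊥-elim (<⇒≱ m<p (prime∣n!⇒≤ m pp p∣m!))

θ≤θ[1+m]+θ∣[2m]Cm : ∀ m y → y ≤ suc (2 * m) → θ y ≤ θ (suc m) + θ∣ y ((2 * m) C m)
θ≤θ[1+m]+θ∣[2m]Cm m y y≤1+2m with y ≤? suc m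
... | yes y≤1+m = ≤-trans (∑-mono-range _ y≤1+m) (m≤m+n (θ (suc m)) _)
θ≤θ[1+m]+θ∣[2m]Cm m zero    _      | no _     = z≤n
θ≤θ[1+m]+θ∣[2m]Cm m (suc y) y<1+2m | no 1+y≰1+m = begin
  θ y + when (prime? y) ⌊log₂ y ⌋                                  ≤⟨ +-mono-≤ (θ≤θ[1+m]+θ∣[2m]Cm m y (<⇒≤ y<1+2m))
                                                                                (new-prime (prime? y)) ⟩
  θ (suc m) + θ∣ y B + when (prime? y) (when (y ∣? B) ⌊log₂ y ⌋)   ≡⟨ +-assoc (θ (suc m)) (θ∣ y B) _ ⟩
  θ (suc m) + θ∣ (suc y) B                                         ∎
  where
  open ≤-Reasoning
  B = (2 * m) C m
  new-prime : (y? : Dec (Prime y)) → when y? ⌊log₂ y ⌋ ≤ when y? (when (y ∣? B) ⌊log₂ y ⌋)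
  new-prime (no _)   = z≤n
  new-prime (yes py) with y ∣? B
  ... | yes _  = ≤-refl
  ... | no y∤B = ⊥-elim (y∤B (prime∣[2m]Cm py (≤-pred (≰⇒> 1+y≰1+m)) (≤-pred y<1+2m)))

θ[1+2m]≤θ[1+m]+2m : ∀ m → θ (suc (2 * m)) ≤ θ (suc m) + 2 * m
θ[1+2m]≤θ[1+m]+2m m = ≤-trans (θ≤θ[1+m]+θ∣[2m]Cm m (suc (2 * m)) ≤-refl) (+-monoʳ-≤ (θ (suc m)) θ∣B≤2m)
  where
  B = (2 * m) C m
  instance
    _ : NonZero B
    _ = m*n≢0⇒m≢0 B {{subst NonZero (sym ([2m]Cm*m!*m!≡[2m]! m)) ((2 * m) !≢0)}}
  θ∣B≤2m : θ∣ (suc (2 * m)) B ≤ 2 * m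
  θ∣B≤2m = 2^m≤2^n⇒m≤n (≤-trans (2^θ∣≤ (suc (2 * m)) B) (nCk≤2^n (2 * m) m))

chebyshev : ∀ j → θ (suc (2 ^ j)) ≤ 2 ^ suc j
chebyshev zero    = z≤n
chebyshev (suc j) = begin
  θ (suc (2 * 2 ^ j))          ≤⟨ θ[1+2m]≤θ[1+m]+2m (2 ^ j) ⟩
  θ (suc (2 ^ j)) + 2 * 2 ^ j  ≤⟨ +-monoˡ-≤ (2 ^ suc j) (chebyshev j) ⟩
  2 ^ suc j + 2 ^ suc j        ≡⟨ 2^[1+n]≡2^n+2^n (suc j) ⟨
  2 ^ suc (suc j)              ∎
  where open ≤-Reasoning

⌊log₂p⌋*⌊a*n/p⌋ₚ≤ : ∀ a n p →
  ⌊log₂ p ⌋ * ⌊ a * n / p ⌋ₚ ≤ a * (⌊log₂ p ⌋ * ⌊ n / p ⌋ₚ) + a * when (prime? p) ⌊log₂ p ⌋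
⌊log₂p⌋*⌊a*n/p⌋ₚ≤ a n p with prime? p
... | no _   = ≤-trans (≤-reflexive (*-zeroʳ ⌊log₂ p ⌋)) z≤n
... | yes pp = begin
  ⌊log₂ p ⌋ * ⌊ a * n / p ⌋                    ≤⟨ *-monoʳ-≤ ⌊log₂ p ⌋
                                                    (⌊a*n/d⌋≤a*[1+⌊n/d⌋] a n p {{prime⇒nonZero pp}}) ⟩
  ⌊log₂ p ⌋ * (a * suc ⌊ n / p ⌋)              ≡⟨ expand ⌊log₂ p ⌋ a ⌊ n / p ⌋ ⟩
  a * (⌊log₂ p ⌋ * ⌊ n / p ⌋) + a * ⌊log₂ p ⌋  ∎
  where
  open ≤-Reasoning
  expand : ∀ l a q → l * (a * suc q) ≡ a * (l * q) + a * l
  expand = solve-∀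

mertens-scaled : ∀ a k → ∑[ p < 2 ^ suc k ] (⌊log₂ p ⌋ * ⌊ a * 2 ^ suc k / p ⌋ₚ) ≤ a * 2 ^ suc k * (k + 3)
mertens-scaled a k = begin
  ∑[ p < m ] (⌊log₂ p ⌋ * ⌊ a * m / p ⌋ₚ)        ≤⟨ ∑-mono-≤ m (λ p _ → ⌊log₂p⌋*⌊a*n/p⌋ₚ≤ a m p) ⟩
  ∑[ p < m ] (a * W p + a * θ-term p)          ≡⟨ ∑-distrib-+ m (λ p → a * W p) (λ p → a * θ-term p) ⟩
  ∑[ p < m ] (a * W p) + ∑[ p < m ] (a * θ-term p)
                                               ≡⟨ cong₂ _+_ (∑-distribˡ-* m a W) (∑-distribˡ-* m a θ-term) ⟩
  a * ∑< m W + a * θ m                         ≤⟨ +-mono-≤ (*-monoʳ-≤ a (mertens m m (suc k) ≤-refl))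
                                                           (*-monoʳ-≤ a θm≤2m) ⟩
  a * (m * suc k) + a * (2 * m)                ≡⟨ collect a m k ⟩
  a * m * (k + 3)                              ∎
  where
  open ≤-Reasoning
  m = 2 ^ suc k
  W θ-term : ℕ → ℕ
  W p = ⌊log₂ p ⌋ * ⌊ m / p ⌋ₚ
  θ-term p = when (prime? p) ⌊log₂ p ⌋
  θm≤2m : θ m ≤ 2 * m
  θm≤2m = ≤-trans (∑-mono-range θ-term (n≤1+n m)) (chebyshev (suc k))
  collect : ∀ a m k → a * (m * suc k) + a * (2 * m) ≡ a * m * (k + 3)
  collect = solve-∀

mertens-dyadic : ∀ K k → k ≤ K → ∑[ p < 2 ^ suc k ] (⌊log₂ p ⌋ * ⌊ 2 ^ suc K / p ⌋ₚ) ≤ 2 ^ suc K * (k + 3)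
mertens-dyadic K k k≤K = subst (λ n → ∑[ p < 2 ^ suc k ] (⌊log₂ p ⌋ * ⌊ n / p ⌋ₚ) ≤ n * (k + 3))
  2^[K∸k]*2^[1+k]≡2^[1+K] (mertens-scaled (2 ^ (K ∸ k)) k)
  where
  2^[K∸k]*2^[1+k]≡2^[1+K] : 2 ^ (K ∸ k) * 2 ^ suc k ≡ 2 ^ suc K
  2^[K∸k]*2^[1+k]≡2^[1+K] = trans (sym (^-distribˡ-+-* 2 (K ∸ k) (suc k)))
    (cong (2 ^_) (trans (+-suc (K ∸ k) k) (cong suc (m∸n+n≡m k≤K))))

dyadicBlock : (ℕ → ℕ) → ℕ → ℕ
dyadicBlock f j = ∑[ r < 2 ^ j ] f (2 ^ j + r)

∑-dyadic : ∀ (f : ℕ → ℕ) → f 0 + f 1 ≡ 0 → ∀ k → ∑< (2 ^ suc k) f ≡ ∑[ i < k ] dyadicBlock f (suc i)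
∑-dyadic f f0+f1≡0 zero    = f0+f1≡0
∑-dyadic f f0+f1≡0 (suc k) = begin
  ∑< (2 ^ suc (suc k)) f                                    ≡⟨ cong (λ m → ∑< m f) (2^[1+n]≡2^n+2^n (suc k)) ⟩
  ∑< (2 ^ suc k + 2 ^ suc k) f                              ≡⟨ ∑-split (2 ^ suc k) (2 ^ suc k) f ⟩
  ∑< (2 ^ suc k) f + dyadicBlock f (suc k)                  ≡⟨ cong (_+ dyadicBlock f (suc k)) (∑-dyadic f f0+f1≡0 k) ⟩
  ∑[ i < k ] dyadicBlock f (suc i) + dyadicBlock f (suc k)  ∎
  where open ≡-Reasoning

dyadicBlock-⌊log₂⌋ : ∀ (f : ℕ → ℕ) j → dyadicBlock (λ p → ⌊log₂ p ⌋ * f p) j ≡ j * dyadicBlock f j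
dyadicBlock-⌊log₂⌋ f j = trans (∑-cong (2 ^ j) ⌊log₂⌋≡j) (∑-distribˡ-* (2 ^ j) j (λ r → f (2 ^ j + r)))
  where
  ⌊log₂⌋≡j : ∀ r → r < 2 ^ j → ⌊log₂ (2 ^ j + r) ⌋ * f (2 ^ j + r) ≡ j * f (2 ^ j + r)
  ⌊log₂⌋≡j r r<2^j = cong (_* f (2 ^ j + r)) (2^j≤n<2^[1+j]⇒⌊log₂n⌋≡j {j} (m≤m+n (2 ^ j) r)
    (subst (2 ^ j + r <_) (sym (2^[1+n]≡2^n+2^n j)) (+-monoʳ-< (2 ^ j) r<2^j)))

module _ (n : ℕ) where

  primeBlock : ℕ → ℕ
  primeBlock i = dyadicBlock ⌊ n /_⌋ₚ (suc i)

  ∑⌊n/p⌋ₚ≡∑primeBlock : ∀ k → ∑[ p < 2 ^ suc k ] ⌊ n / p ⌋ₚ ≡ ∑< k primeBlock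
  ∑⌊n/p⌋ₚ≡∑primeBlock = ∑-dyadic ⌊ n /_⌋ₚ refl

  ∑⌊log₂p⌋*⌊n/p⌋ₚ≡∑[1+i]*primeBlock : ∀ k →
    ∑[ p < 2 ^ suc k ] (⌊log₂ p ⌋ * ⌊ n / p ⌋ₚ) ≡ ∑[ i < k ] (suc i * primeBlock i)
  ∑⌊log₂p⌋*⌊n/p⌋ₚ≡∑[1+i]*primeBlock k = trans (∑-dyadic (λ p → ⌊log₂ p ⌋ * ⌊ n / p ⌋ₚ) refl k)
    (∑-cong k (λ i _ → dyadicBlock-⌊log₂⌋ ⌊ n /_⌋ₚ (suc i)))

-- The comparison sequence b satisfies (2 + i) * b (1 + i) ≥ n, so its weighted partial sums
-- dominate the bound n * (k + 3) of mertens-dyadic.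
∑⌊n/p⌋ₚ≤ : ∀ K →
  ∑[ p < 2 ^ (2 + K) ] ⌊ 2 ^ (2 + K) / p ⌋ₚ ≤ 4 * 2 ^ (2 + K) + K + ∑[ i < K ] ⌊ 2 ^ (2 + K) / (2 + i) ⌋
∑⌊n/p⌋ₚ≤ K = begin
  ∑[ p < n ] ⌊ n / p ⌋ₚ            ≡⟨ ∑⌊n/p⌋ₚ≡∑primeBlock n (suc K) ⟩
  ∑< (suc K) (primeBlock n)       ≤⟨ abel-≤ (primeBlock n) b (suc K) weighted≤ ⟩
  ∑< (suc K) b                    ≡⟨ ∑-shift K b ⟩
  4 * n + ∑[ i < K ] (1 + H i)    ≡⟨ cong (_+_ (4 * n)) (∑-distrib-+ K (λ _ → 1) H) ⟩
  4 * n + (∑[ _ < K ] 1 + ∑< K H) ≡⟨ cong (λ x → 4 * n + (x + ∑< K H)) (trans (∑-const K 1) (*-identityʳ K)) ⟩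
  4 * n + (K + ∑< K H)            ≡⟨ +-assoc (4 * n) K (∑< K H) ⟨
  4 * n + K + ∑< K H              ∎
  where
  open ≤-Reasoning
  n = 2 ^ (2 + K)
  H b : ℕ → ℕ
  H i = ⌊ n / (2 + i) ⌋
  b zero    = 4 * n
  b (suc i) = suc (H i)
  n≤[2+i]*b[1+i] : ∀ i → n ≤ (2 + i) * b (suc i)
  n≤[2+i]*b[1+i] i = ≤-trans (<⇒≤ (n<[1+⌊n/d⌋]*d n (2 + i))) (≤-reflexive (*-comm (suc (H i)) (2 + i)))
  weighted≤ : ∀ k → k ≤ suc K → ∑[ i < k ] (suc i * primeBlock n i) ≤ ∑[ i < k ] (suc i * b i)
  weighted≤ zero    _     = z≤n
  weighted≤ (suc k) 1+k≤1+K = begin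
    ∑[ i < suc k ] (suc i * primeBlock n i)          ≡⟨ ∑⌊log₂p⌋*⌊n/p⌋ₚ≡∑[1+i]*primeBlock n (suc k) ⟨
    ∑[ p < 2 ^ (2 + k) ] (⌊log₂ p ⌋ * ⌊ n / p ⌋ₚ)    ≤⟨ mertens-dyadic (suc K) (suc k) 1+k≤1+K ⟩
    n * (suc k + 3)                                 ≡⟨ expand n k ⟩
    1 * (4 * n) + k * n                             ≡⟨ cong (_+_ (1 * (4 * n))) (∑-const k n) ⟨
    1 * (4 * n) + ∑[ _ < k ] n                      ≤⟨ +-monoʳ-≤ (1 * (4 * n))
                                                         (∑-mono-≤ k (λ i _ → n≤[2+i]*b[1+i] i)) ⟩
    1 * (4 * n) + ∑[ i < k ] ((2 + i) * b (suc i))  ≡⟨ ∑-shift k (λ i → suc i * b i) ⟨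
    ∑[ i < suc k ] (suc i * b i)                    ∎
    where
    expand : ∀ n k → n * (suc k + 3) ≡ 1 * (4 * n) + k * n
    expand = solve-∀

oddPrimeSum≤∑ : ∀ f N → oddPrimeSum f N ≤ ∑[ p < suc N ] when (prime? p) (f p)
oddPrimeSum≤∑ f zero    = z≤n
oddPrimeSum≤∑ f (suc N) with prime? (suc N) | 2 <? suc N
... | yes _ | yes _ = +-monoˡ-≤ (f (suc N)) (oddPrimeSum≤∑ f N)
... | yes _ | no _  = ≤-trans (oddPrimeSum≤∑ f N) (m≤m+n _ _)
... | no _  | _     = ≤-trans (oddPrimeSum≤∑ f N) (m≤m+n _ _)

-- With g = ⌊ n /_⌋ this is the exponent e for which p/(p - 2) = p/(p - 1) · (p - 1)/(p - 2) ≤ (1 + 1/n)^e.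
eulerExponent : (ℕ → ℕ) → ℕ → ℕ
eulerExponent g p = suc (g (p ∸ 1)) + suc (g (p ∸ 2))

module _ (g : ℕ → ℕ) (antitone : ∀ d → g (2 + d) ≤ g (1 + d)) where

  private
    skip : ∀ N D R → D + g (1 + N) + 2 * g (2 + N) ≤ R + 2 * (3 + N) →
           D + g (2 + N) + 2 * g (3 + N) ≤ R + 2 * (4 + N)
    skip N D R le = begin
      D + g (2 + N) + 2 * g (3 + N)  ≤⟨ +-mono-≤ (+-monoʳ-≤ D (antitone N)) (*-monoʳ-≤ 2 (antitone (suc N))) ⟩
      D + g (1 + N) + 2 * g (2 + N)  ≤⟨ le ⟩
      R + 2 * (3 + N)                ≤⟨ +-monoʳ-≤ R (*-monoʳ-≤ 2 (n≤1+n (3 + N))) ⟩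
      R + 2 * (4 + N)                ∎
      where open ≤-Reasoning

  -- Consecutive odd primes differ by at least 2, so g (p ∸ 1) and g (p ∸ 2) are at most g at the
  -- previous odd prime; the terms g (1 + N) + 2 * g (2 + N) carry this through the induction.
  oddPrimeSum-gaps : ∀ N → oddPrimeSum (eulerExponent g) (2 + N) + g (1 + N) + 2 * g (2 + N)
                           ≤ 2 * oddPrimeSum g (2 + N) + g 1 + 2 * g 2 + 2 * (3 + N)
  oddPrimeSum-gaps zero    = m≤m+n _ _
  oddPrimeSum-gaps (suc N) with prime? (3 + N) | 2 <? 3 + N | oddPrimeSum-gaps N
  ... | yes _ | yes _ | ih = begin
    S + (suc (g (2 + N)) + suc (g (1 + N))) + g (2 + N) + 2 * g (3 + N)
                                                       ≡⟨ regroup S (g (1 + N)) (g (2 + N)) (g (3 + N)) ⟩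
    (S + g (1 + N) + 2 * g (2 + N)) + (2 + 2 * g (3 + N))        ≤⟨ +-monoˡ-≤ (2 + 2 * g (3 + N)) ih ⟩
    (2 * P + g 1 + 2 * g 2 + 2 * (3 + N)) + (2 + 2 * g (3 + N))  ≡⟨ collect P (g 1) (g 2) (g (3 + N)) N ⟩
    2 * (P + g (3 + N)) + g 1 + 2 * g 2 + 2 * (4 + N)            ∎
    where
    open ≤-Reasoning
    S = oddPrimeSum (eulerExponent g) (2 + N)
    P = oddPrimeSum g (2 + N)
    regroup : ∀ s a b c → s + (suc b + suc a) + b + 2 * c ≡ (s + a + 2 * b) + (2 + 2 * c)
    regroup = solve-∀
    collect : ∀ p a b c k →
      (2 * p + a + 2 * b + 2 * (3 + k)) + (2 + 2 * c) ≡ 2 * (p + c) + a + 2 * b + 2 * (4 + k)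
    collect = solve-∀
  ... | yes _ | no _  | ih =
    skip N (oddPrimeSum (eulerExponent g) (2 + N)) (2 * oddPrimeSum g (2 + N) + g 1 + 2 * g 2) ih
  ... | no _  | _     | ih =
    skip N (oddPrimeSum (eulerExponent g) (2 + N)) (2 * oddPrimeSum g (2 + N) + g 1 + 2 * g 2) ih

oddPrimeSum⌊n/p⌋≤ : ∀ K N → 2 + N < 2 ^ (2 + K) →
  oddPrimeSum ⌊ 2 ^ (2 + K) /_⌋ (2 + N) ≤ 5 * 2 ^ (2 + K) + ∑[ i < K ] ⌊ 2 ^ (2 + K) / (2 + i) ⌋
oddPrimeSum⌊n/p⌋≤ K N N<n = begin
  oddPrimeSum ⌊ n /_⌋ (2 + N)  ≤⟨ oddPrimeSum≤∑ ⌊ n /_⌋ (2 + N) ⟩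
  ∑[ p < 3 + N ] ⌊ n / p ⌋ₚ    ≤⟨ ∑-mono-range ⌊ n /_⌋ₚ N<n ⟩
  ∑[ p < n ] ⌊ n / p ⌋ₚ        ≤⟨ ∑⌊n/p⌋ₚ≤ K ⟩
  4 * n + K + H                ≤⟨ +-monoˡ-≤ H (+-monoʳ-≤ (4 * n) K≤n) ⟩
  4 * n + n + H                ≡⟨ cong (_+ H) (+-comm (4 * n) n) ⟩
  5 * n + H                    ∎
  where
  open ≤-Reasoning
  n = 2 ^ (2 + K)
  H = ∑[ i < K ] ⌊ n / (2 + i) ⌋
  K≤n : K ≤ n
  K≤n = ≤-trans (n≤1+n K) (≤-trans (n≤1+n (suc K)) (<⇒≤ (n<2^n (2 + K))))

oddPrimeSum-eulerExponent≤ : ∀ K N → 2 + N < 2 ^ (2 + K) →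
  oddPrimeSum (eulerExponent ⌊ 2 ^ (2 + K) /_⌋) (2 + N) ≤ 30 * 2 ^ suc K + 2 * ∑[ i < K ] ⌊ 2 ^ (2 + K) / (2 + i) ⌋
oddPrimeSum-eulerExponent≤ K N N<n = begin
  T                                          ≤⟨ m≤m+n T (g (1 + N) + 2 * g (2 + N)) ⟩
  T + (g (1 + N) + 2 * g (2 + N))            ≡⟨ +-assoc T (g (1 + N)) (2 * g (2 + N)) ⟨
  T + g (1 + N) + 2 * g (2 + N)              ≤⟨ oddPrimeSum-gaps g (λ d → ⌊/⌋-antitone n (n≤1+n (suc d))) N ⟩
  2 * P + g 1 + 2 * g 2 + 2 * (3 + N)        ≤⟨ +-mono-≤ (+-mono-≤ (+-monoʳ-≤ (2 * P) (⌊n/d⌋≤n n 1))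
                                                                    (*-monoʳ-≤ 2 (⌊n/d⌋≤n n 2)))
                                                          (*-monoʳ-≤ 2 N<n) ⟩
  2 * P + n + 2 * n + 2 * n                  ≤⟨ +-monoˡ-≤ (2 * n) (+-monoˡ-≤ (2 * n) (+-monoˡ-≤ n
                                                  (*-monoʳ-≤ 2 (oddPrimeSum⌊n/p⌋≤ K N N<n)))) ⟩
  2 * (5 * n + H) + n + 2 * n + 2 * n        ≡⟨ collect (2 ^ suc K) H ⟩
  30 * 2 ^ suc K + 2 * H                     ∎
  where
  open ≤-Reasoning
  n = 2 ^ (2 + K)
  g : ℕ → ℕ
  g = ⌊ n /_⌋
  T = oddPrimeSum (eulerExponent g) (2 + N)
  P = oddPrimeSum g (2 + N)
  H = ∑[ i < K ] ⌊ n / (2 + i) ⌋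
  collect : ∀ h H → 2 * (5 * (2 * h) + H) + 2 * h + 2 * (2 * h) + 2 * (2 * h) ≡ 30 * h + 2 * H
  collect = solve-∀

*-cross-≤ : ∀ {a b c d x y u v} → a * x ≤ c * u → b * y ≤ d * v → (a * b) * (x * y) ≤ (c * d) * (u * v)
*-cross-≤ {a} {b} {c} {d} {x} {y} {u} {v} ax≤cu by≤dv = begin
  (a * b) * (x * y)  ≡⟨ interchange a b x y ⟩
  (a * x) * (b * y)  ≤⟨ *-mono-≤ ax≤cu by≤dv ⟩
  (c * u) * (d * v)  ≡⟨ interchange c u d v ⟩
  (c * d) * (u * v)  ∎
  where
  open ≤-Reasoning
  interchange : ∀ a b c d → (a * b) * (c * d) ≡ (a * c) * (b * d)
  interchange = solve-∀

-- ρ = 1 + 1/n, with denominators cleared: a ∶ c ≤ρ^ e means a/c ≤ ρ^e and ρ^ e ≤ a ∶ c means ρ^e ≤ a/c.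
module ρ-Powers (n : ℕ) {{_ : NonZero n}} where

  infix 4 _∶_≤ρ^_ ρ^_≤_∶_

  record _∶_≤ρ^_ (a c e : ℕ) : Set where
    constructor ≤ρ^-intro
    field ≤ρ^-elim : a * n ^ e ≤ c * suc n ^ e

  record ρ^_≤_∶_ (e a c : ℕ) : Set where
    constructor ρ^≤-intro
    field ρ^≤-elim : c * suc n ^ e ≤ a * n ^ e

  open _∶_≤ρ^_ public
  open ρ^_≤_∶_ public

  ≤ρ^-* : ∀ {a₁ c₁ e₁ a₂ c₂ e₂} → a₁ ∶ c₁ ≤ρ^ e₁ → a₂ ∶ c₂ ≤ρ^ e₂ → a₁ * a₂ ∶ c₁ * c₂ ≤ρ^ e₁ + e₂
  ≤ρ^-* {a₁} {c₁} {e₁} {a₂} {c₂} {e₂} (≤ρ^-intro le₁) (≤ρ^-intro le₂) = ≤ρ^-intro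
    (subst₂ (λ x y → a₁ * a₂ * x ≤ c₁ * c₂ * y)
      (sym (^-distribˡ-+-* n e₁ e₂)) (sym (^-distribˡ-+-* (suc n) e₁ e₂))
      (*-cross-≤ {a₁} {a₂} {c₁} {c₂} {n ^ e₁} {n ^ e₂} le₁ le₂))

  ρ^≤-* : ∀ {a₁ c₁ e₁ a₂ c₂ e₂} → ρ^ e₁ ≤ a₁ ∶ c₁ → ρ^ e₂ ≤ a₂ ∶ c₂ → ρ^ e₁ + e₂ ≤ a₁ * a₂ ∶ c₁ * c₂
  ρ^≤-* {a₁} {c₁} {e₁} {a₂} {c₂} {e₂} (ρ^≤-intro le₁) (ρ^≤-intro le₂) = ρ^≤-intro
    (subst₂ (λ x y → c₁ * c₂ * x ≤ a₁ * a₂ * y)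
      (sym (^-distribˡ-+-* (suc n) e₁ e₂)) (sym (^-distribˡ-+-* n e₁ e₂))
      (*-cross-≤ {c₁} {c₂} {a₁} {a₂} {suc n ^ e₁} {suc n ^ e₂} le₁ le₂))

  ≤ρ^-ratio : ∀ {a b c d e} .{{_ : NonZero d}} → b ∶ d ≤ρ^ e → a * d ≤ c * b → a ∶ c ≤ρ^ e
  ≤ρ^-ratio {a} {b} {c} {d} {e} (≤ρ^-intro b∶d≤) ad≤cb =
    ≤ρ^-intro (*-cancelʳ-≤ (a * n ^ e) (c * suc n ^ e) d (begin
    a * n ^ e * d        ≡⟨ swap a (n ^ e) d ⟩
    a * d * n ^ e        ≤⟨ *-monoˡ-≤ (n ^ e) ad≤cb ⟩
    c * b * n ^ e        ≡⟨ *-assoc c b (n ^ e) ⟩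
    c * (b * n ^ e)      ≤⟨ *-monoʳ-≤ c b∶d≤ ⟩
    c * (d * suc n ^ e)  ≡⟨ rotate c d (suc n ^ e) ⟩
    c * suc n ^ e * d    ∎))
    where
    open ≤-Reasoning
    swap : ∀ a x d → a * x * d ≡ a * d * x
    swap = solve-∀
    rotate : ∀ c d x → c * (d * x) ≡ c * x * d
    rotate = solve-∀

  ρ^≤-ratio : ∀ {a b c d e} .{{_ : NonZero b}} → ρ^ e ≤ b ∶ d → b * c ≤ a * d → ρ^ e ≤ a ∶ c
  ρ^≤-ratio {a} {b} {c} {d} {e} (ρ^≤-intro ρ^≤b∶d) bc≤ad =
    ρ^≤-intro (*-cancelʳ-≤ (c * suc n ^ e) (a * n ^ e) b (begin
    c * suc n ^ e * b      ≡⟨ rearrange c (suc n ^ e) b ⟩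
    b * c * suc n ^ e      ≤⟨ *-monoˡ-≤ (suc n ^ e) bc≤ad ⟩
    a * d * suc n ^ e      ≡⟨ *-assoc a d (suc n ^ e) ⟩
    a * (d * suc n ^ e)    ≤⟨ *-monoʳ-≤ a ρ^≤b∶d ⟩
    a * (b * n ^ e)        ≡⟨ rotate a b (n ^ e) ⟩
    a * n ^ e * b          ∎))
    where
    open ≤-Reasoning
    rearrange : ∀ c x b → c * x * b ≡ b * c * x
    rearrange = solve-∀
    rotate : ∀ a b x → a * (b * x) ≡ a * x * b
    rotate = solve-∀

  ρ^≤-antitone : ∀ {a c e e′} → e ≤ e′ → ρ^ e′ ≤ a ∶ c → ρ^ e ≤ a ∶ c
  ρ^≤-antitone {a} {c} {e} e≤e′ (ρ^≤-intro ρ^e′≤) with m≤n⇒∃[o]m+o≡n e≤e′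
  ... | d , refl = ρ^≤-intro (*-cancelʳ-≤ (c * suc n ^ e) (a * n ^ e) (n ^ d) {{m^n≢0 n d}} (begin
    c * suc n ^ e * n ^ d         ≤⟨ *-monoʳ-≤ (c * suc n ^ e) (^-monoˡ-≤ d (n≤1+n n)) ⟩
    c * suc n ^ e * suc n ^ d     ≡⟨ *-assoc c (suc n ^ e) (suc n ^ d) ⟩
    c * (suc n ^ e * suc n ^ d)   ≡⟨ cong (c *_) (^-distribˡ-+-* (suc n) e d) ⟨
    c * suc n ^ (e + d)           ≤⟨ ρ^e′≤ ⟩
    a * n ^ (e + d)               ≡⟨ cong (a *_) (^-distribˡ-+-* n e d) ⟩
    a * (n ^ e * n ^ d)           ≡⟨ *-assoc a (n ^ e) (n ^ d) ⟨
    a * n ^ e * n ^ d             ∎))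
    where open ≤-Reasoning

  bernoulli : ∀ e → n + e ∶ n ≤ρ^ e
  bernoulli zero    = ≤ρ^-intro (≤-reflexive (cong (_* 1) (+-identityʳ n)))
  bernoulli (suc e) = ≤ρ^-intro (begin
    (n + suc e) * n ^ suc e          ≡⟨ rearrange n e (n ^ e) ⟩
    n * (n + suc e) * n ^ e          ≤⟨ *-monoˡ-≤ (n ^ e) (≤-trans (m≤m+n (n * (n + suc e)) e)
                                                                   (≤-reflexive (expand n e))) ⟩
    suc n * (n + e) * n ^ e          ≡⟨ *-assoc (suc n) (n + e) (n ^ e) ⟩
    suc n * ((n + e) * n ^ e)        ≤⟨ *-monoʳ-≤ (suc n) (≤ρ^-elim (bernoulli e)) ⟩
    suc n * (n * suc n ^ e)          ≡⟨ x∙yz≈y∙xz (suc n) n (suc n ^ e) ⟩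
    n * suc n ^ suc e                ∎)
    where
    open ≤-Reasoning
    rearrange : ∀ n e x → (n + suc e) * (n * x) ≡ n * (n + suc e) * x
    rearrange = solve-∀
    expand : ∀ n e → n * (n + suc e) + e ≡ suc n * (n + e)
    expand = solve-∀

  [1+j]∶j≤ρ^[1+⌊n/j⌋] : ∀ j .{{_ : NonZero j}} → suc j ∶ j ≤ρ^ suc ⌊ n / j ⌋
  [1+j]∶j≤ρ^[1+⌊n/j⌋] j = ≤ρ^-ratio (bernoulli (suc ⌊ n / j ⌋)) (begin
    suc j * n                    ≤⟨ +-monoˡ-≤ (j * n) n≤j*[1+⌊n/j⌋] ⟩
    j * suc ⌊ n / j ⌋ + j * n    ≡⟨ +-comm (j * suc ⌊ n / j ⌋) (j * n) ⟩
    j * n + j * suc ⌊ n / j ⌋    ≡⟨ *-distribˡ-+ j n (suc ⌊ n / j ⌋) ⟨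
    j * (n + suc ⌊ n / j ⌋)      ∎)
    where
    open ≤-Reasoning
    n≤j*[1+⌊n/j⌋] : n ≤ j * suc ⌊ n / j ⌋
    n≤j*[1+⌊n/j⌋] = ≤-trans (<⇒≤ (n<[1+⌊n/d⌋]*d n j)) (≤-reflexive (*-comm (suc ⌊ n / j ⌋) j))

  p∶[p∸2]≤ρ^eulerExponent : ∀ p → 2 < p → p ∶ p ∸ 2 ≤ρ^ eulerExponent ⌊ n /_⌋ p
  p∶[p∸2]≤ρ^eulerExponent (suc (suc (suc r))) _ =
    ≤ρ^-ratio (≤ρ^-* ([1+j]∶j≤ρ^[1+⌊n/j⌋] (2 + r)) ([1+j]∶j≤ρ^[1+⌊n/j⌋] (1 + r))) (≤-reflexive (cancel r))
    where
    cancel : ∀ r → (3 + r) * ((2 + r) * (1 + r)) ≡ (1 + r) * ((3 + r) * (2 + r))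
    cancel = solve-∀
  p∶[p∸2]≤ρ^eulerExponent 1 (s≤s ())
  p∶[p∸2]≤ρ^eulerExponent 2 (s≤s (s≤s ()))

  ρ^0≤1∶1 : ρ^ 0 ≤ 1 ∶ 1
  ρ^0≤1∶1 = ρ^≤-intro ≤-refl

  ρ^1≤[1+r]∶r : ∀ {r} → r ≤ n → ρ^ 1 ≤ suc r ∶ r
  ρ^1≤[1+r]∶r {r} r≤n = ρ^≤-intro (begin
    r * (suc n * 1)    ≡⟨ expand r n ⟩
    r + r * n          ≤⟨ +-monoˡ-≤ (r * n) r≤n ⟩
    n + r * n          ≡⟨ *-identityʳ (suc r * n) ⟨
    suc r * n * 1      ≡⟨ *-assoc (suc r) n 1 ⟩
    suc r * (n * 1)    ∎)
    where
    open ≤-Reasoning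
    expand : ∀ r n → r * (suc n * 1) ≡ r + r * n
    expand = solve-∀

  ρ^m≤n∶r : ∀ m r → m + r ≡ n → ρ^ m ≤ n ∶ r
  ρ^m≤n∶r zero    r r≡n = ρ^≤-intro (≤-reflexive (cong (_* 1) r≡n))
  ρ^m≤n∶r (suc m) r m+1+r≡n =
    ρ^≤-ratio {{m*n≢0 (suc r) n}} (ρ^≤-* (ρ^1≤[1+r]∶r r≤n) (ρ^m≤n∶r m (suc r) (trans (+-suc m r) m+1+r≡n)))
      (≤-reflexive (rearrange r n))
    where
    r≤n : r ≤ n
    r≤n = subst (r ≤_) m+1+r≡n (m≤n+m r (suc m))
    rearrange : ∀ r n → suc r * n * r ≡ n * (r * suc r)
    rearrange = solve-∀

  ρ^⌊n/[1+j]⌋≤[1+j]∶j : ∀ j → ρ^ ⌊ n / suc j ⌋ ≤ suc j ∶ j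
  ρ^⌊n/[1+j]⌋≤[1+j]∶j j = ρ^≤-ratio (ρ^m≤n∶r q r (m+[n∸m]≡n q≤n)) (begin
    n * j              ≡⟨ cong (_* j) (sym (m+[n∸m]≡n q≤n)) ⟩
    (q + r) * j        ≡⟨ *-distribʳ-+ j q r ⟩
    q * j + r * j      ≤⟨ +-monoˡ-≤ (r * j) q*j≤r ⟩
    r + r * j          ≡⟨ *-suc r j ⟨
    r * suc j          ≡⟨ *-comm r (suc j) ⟩
    suc j * r          ∎)
    where
    open ≤-Reasoning
    q = ⌊ n / suc j ⌋
    r = n ∸ q
    q*[1+j]≤n : q * suc j ≤ n
    q*[1+j]≤n = ⌊n/d⌋*d≤n n (suc j)
    q≤n : q ≤ n
    q≤n = ⌊n/d⌋≤n n (suc j)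
    q*j≤r : q * j ≤ r
    q*j≤r = +-cancelˡ-≤ q (q * j) r (begin
      q + q * j    ≡⟨ *-suc q j ⟨
      q * suc j    ≤⟨ q*[1+j]≤n ⟩
      n            ≡⟨ m+[n∸m]≡n q≤n ⟨
      q + r        ∎)

  ρ^h≤2∶1 : ∀ h → h + h ≡ n → ρ^ h ≤ 2 ∶ 1
  ρ^h≤2∶1 h h+h≡n = ρ^≤-ratio (ρ^m≤n∶r h h h+h≡n)
    (≤-reflexive (trans (*-identityʳ n) (trans (sym h+h≡n) (cong (_+_ h) (sym (+-identityʳ h))))))

  ρ^≤-^ : ∀ {a c e} → ρ^ e ≤ a ∶ c → ∀ k → ρ^ k * e ≤ a ^ k ∶ c ^ k
  ρ^≤-^ ρ^e≤ zero    = ρ^0≤1∶1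
  ρ^≤-^ ρ^e≤ (suc k) = ρ^≤-* ρ^e≤ (ρ^≤-^ ρ^e≤ k)

  ρ^∑⌊n/[2+i]⌋≤1+k : ∀ k → ρ^ ∑[ i < k ] ⌊ n / (2 + i) ⌋ ≤ suc k ∶ 1
  ρ^∑⌊n/[2+i]⌋≤1+k zero    = ρ^0≤1∶1
  ρ^∑⌊n/[2+i]⌋≤1+k (suc k) =
    ρ^≤-ratio {{m*n≢0 (suc k) (2 + k)}} (ρ^≤-* (ρ^∑⌊n/[2+i]⌋≤1+k k) (ρ^⌊n/[1+j]⌋≤[1+j]∶j (suc k)))
      (≤-reflexive (telescope k))
    where
    telescope : ∀ k → suc k * (2 + k) * 1 ≡ (2 + k) * (1 * suc k)
    telescope = solve-∀

  ∏p∶∏[p∸2]≤ρ^∑eulerExponent : ∀ N →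
    oddPrimeProduct (λ p → p) N ∶ oddPrimeProduct (_∸ 2) N ≤ρ^ oddPrimeSum (eulerExponent ⌊ n /_⌋) N
  ∏p∶∏[p∸2]≤ρ^∑eulerExponent zero    = ≤ρ^-intro ≤-refl
  ∏p∶∏[p∸2]≤ρ^∑eulerExponent (suc N) with prime? (suc N) | 2 <? suc N
  ... | yes _ | yes 2<1+N = ≤ρ^-* (∏p∶∏[p∸2]≤ρ^∑eulerExponent N) (p∶[p∸2]≤ρ^eulerExponent (suc N) 2<1+N)
  ... | yes _ | no _      = ∏p∶∏[p∸2]≤ρ^∑eulerExponent N
  ... | no _  | _         = ∏p∶∏[p∸2]≤ρ^∑eulerExponent N

  ≤ρ^∧ρ^≤⇒≤ : ∀ {a b c e} → a ∶ c ≤ρ^ e → ρ^ e ≤ b ∶ 1 → a ≤ b * c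
  ≤ρ^∧ρ^≤⇒≤ {a} {b} {c} {e} (≤ρ^-intro a∶c≤) (ρ^≤-intro ρ^e≤) =
    *-cancelʳ-≤ a (b * c) (n ^ e) {{m^n≢0 n e}} (begin
    a * n ^ e              ≤⟨ a∶c≤ ⟩
    c * suc n ^ e          ≡⟨ cong (c *_) (*-identityˡ (suc n ^ e)) ⟨
    c * (1 * suc n ^ e)    ≤⟨ *-monoʳ-≤ c ρ^e≤ ⟩
    c * (b * n ^ e)        ≡⟨ rearrange c b (n ^ e) ⟩
    b * c * n ^ e          ∎)
    where
    open ≤-Reasoning
    rearrange : ∀ c b x → c * (b * x) ≡ b * c * x
    rearrange = solve-∀

∏p≤2^30*[1+K]²*∏[p∸2] : ∀ K N → 2 + N < 2 ^ (2 + K) →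
  oddPrimeProduct (λ p → p) (2 + N) ≤ 2 ^ 30 * suc K ^ 2 * oddPrimeProduct (_∸ 2) (2 + N)
∏p≤2^30*[1+K]²*∏[p∸2] K N N<n = ≤ρ^∧ρ^≤⇒≤ (∏p∶∏[p∸2]≤ρ^∑eulerExponent (2 + N))
  (ρ^≤-antitone (oddPrimeSum-eulerExponent≤ K N N<n)
    (ρ^≤-* (ρ^≤-^ (ρ^h≤2∶1 h h+h≡n) 30) (ρ^≤-^ (ρ^∑⌊n/[2+i]⌋≤1+k K) 2)))
  where
  h = 2 ^ suc K
  n = 2 ^ (2 + K)
  h+h≡n : h + h ≡ n
  h+h≡n = cong (_+_ h) (sym (+-identityʳ h))
  instance
    _ : NonZero n
    _ = m^n≢0 2 (2 + K)
  open ρ-Powers n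

∏p≤2^30*⌊log₂N⌋²*∏[p∸2] : ∀ N → 2 ≤ N →
  oddPrimeProduct (λ p → p) N ≤ 2 ^ 30 * ⌊log₂ N ⌋ ^ 2 * oddPrimeProduct (_∸ 2) N
∏p≤2^30*⌊log₂N⌋²*∏[p∸2] N@(suc (suc N′)) _ =
  subst (λ L → oddPrimeProduct (λ p → p) N ≤ 2 ^ 30 * L ^ 2 * oddPrimeProduct (_∸ 2) N) (sym ⌊log₂N⌋≡1+K)
    (∏p≤2^30*[1+K]²*∏[p∸2] K N′ (subst (λ L → N < 2 ^ suc L) ⌊log₂N⌋≡1+K (n<2^[1+⌊log₂n⌋] N)))
  where
  K = ⌊log₂ N ⌋ ∸ 1
  ⌊log₂N⌋≡1+K : ⌊log₂ N ⌋ ≡ suc K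
  ⌊log₂N⌋≡1+K = sym (m+[n∸m]≡n (⌊log₂⌋-mono-≤ {2} {N} (s≤s (s≤s z≤n))))
∏p≤2^30*⌊log₂N⌋²*∏[p∸2] 1 (s≤s ())

prodFactor≤2^30*⌊log₂N⌋² : ∀ N → 2 ≤ N → prodFactor N ℚ.≤ + (2 ^ 30 * ⌊log₂ N ⌋ ^ 2) ℚ./ 1
prodFactor≤2^30*⌊log₂N⌋² N 2≤N = subst (ℚ._≤ + B ℚ./ 1) (sym (prodFactor≡∏p/∏[p∸2] N))
  (/-cross-≤ (oddPrimeProduct (λ p → p) N) (oddPrimeProduct (_∸ 2) N) B 1 {{∏[p∸2]≢0 N}}
    (≤-trans (≤-reflexive (*-identityʳ (oddPrimeProduct (λ p → p) N))) (∏p≤2^30*⌊log₂N⌋²*∏[p∸2] N 2≤N)))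
  where
  B = 2 ^ 30 * ⌊log₂ N ⌋ ^ 2

proposition2 : ((A : ℕ → Set) → (∀ a → A a → 1 ≤ a) → Primitive A →
    (N : ℕ) → 2 ≤ N →
    (xs : List ℕ) → Unique xs → All (λ a → A a × Smooth N a) xs →
    sumℚ (map term xs) ℚ.≤ prodFactor N)
    × Σ ℕ (λ C → (N : ℕ) → 2 ≤ N →
    prodFactor N ℚ.≤ (+ (C * (⌊log₂ N ⌋ ^ 2))) ℚ./ 1)
proposition2 =
  (λ A positive A-primitive N _ → primitive-sum≤prodFactor A positive A-primitive N) ,  -- the first bound needs no N ≥ 2
  2 ^ 30 , prodFactor≤2^30*⌊log₂N⌋²
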